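{- Let $\sigma$ occur in $\tau$, with $\tau$ having left and right tails with respect to $\sigma$ each of length at most $1$, and let $x$ be the sum of the lengths of the two tails; when $x=1$, assume the right tail has length $0$. If the suffix pattern of $\tau$ of length $|\sigma|+x$ is not monotone, then $\mu(\sigma,\tau)\ne(-1)^{x+1}$.
   Context: Permutations are of $[d]=\{1,\dots,d\}$; $|\pi|$ is the length. An occurrence of a consecutive pattern $\sigma$ in $\tau$ is a factor of consecutive letters of $\tau$ order isomorphic to $\sigma$. Permutations are partially ordered by $\sigma\le\tau$ iff $\sigma$ occurs as a consecutive pattern in $\tau$; $\mu$ is the Möbius function of this poset ($\mu(x,x)=1$, $\mu(x,y)=-\sum_{x\le z<y}\mu(x,z)$ for $x<y$). If $\sigma$ occurs in $\tau=a_1\cdots a_n$, $\tau$ has a left tail of length $i$ w.r.t. $\sigma$ if $a_{i+1}$ is the leftmost letter of $\tau$ involved in any occurrence of $\sigma$, and a right tail of length $j$ if $a_{n-j}$ is the rightmost such letter. The suffix pattern of length $k$ of $\tau$ is the permutation order isomorphic to the suffix of $\tau$ of length $k$. A permutation is monotone if it is $12\cdots n$ or $n\cdots 21$. -}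

module Defs where

open import Data.Nat using (ℕ; zero; suc; _+_; _∸_; _≤_; _<_; _<ᵇ_)
open import Data.Bool using (Bool; true; false; if_then_else_; _∨_)
open import Data.List using (List; []; _∷_; length; map; take; drop; upTo; reverse; filter; deduplicate; concatMap; foldr)
open import Data.List.Properties using (≡-dec)
open import Data.List.Relation.Binary.Permutation.Propositional using (_↭_)
open import Data.Nat.Properties using (_≟_)
open import Data.Integer as ℤ using (ℤ; -_)
open import Data.Product using (_×_)
open import Data.Sum using (_⊎_)
open import Relation.Nullary using (¬_; does)
open import Relation.Binary.PropositionalEquality using (_≡_)

IsPerm : List ℕ → Set
IsPerm p = p ↭ map suc (upTo (length p))

countLess : ℕ → List ℕ → ℕ
countLess a [] = 0
countLess a (b ∷ l) = if b <ᵇ a then suc (countLess a l) else countLess a l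

-- standardization: the permutation order isomorphic to a word of distinct letters
std : List ℕ → List ℕ
std l = map (λ a → suc (countLess a l)) l

-- the factor of τ of length k starting after position i (letters a_{i+1} … a_{i+k})
factor : ℕ → ℕ → List ℕ → List ℕ
factor i k τ = take k (drop i τ)

-- σ occurs (as a consecutive pattern) in τ at position i, i.e. occupying a_{i+1}…a_{i+|σ|}
OccursAt : List ℕ → List ℕ → ℕ → Set
OccursAt σ τ i = (i + length σ ≤ length τ) × (std (factor i (length σ) τ) ≡ σ)

_≼_ : List ℕ → List ℕ → Set
σ ≼ τ = Data.Product.∃ λ i → OccursAt σ τ i

occursAtᵇ : List ℕ → List ℕ → ℕ → Bool
occursAtᵇ σ τ i = ((i + length σ) Data.Nat.≤ᵇ length τ) Data.Bool.∧ does (≡-dec _≟_ (std (factor i (length σ) τ)) σ)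

occursᵇ : List ℕ → List ℕ → Bool
occursᵇ σ τ = foldr (λ i b → occursAtᵇ σ τ i ∨ b) false (upTo (suc (length τ)))

-- all patterns z ≤ τ with |z| < |τ| (i.e. z < τ, for τ a permutation), without repetition
properPatterns : List ℕ → List (List ℕ)
properPatterns τ = deduplicate (≡-dec _≟_)
  (concatMap (λ k → map (λ i → std (factor i k τ)) (upTo (suc (length τ ∸ k))))
             (upTo (length τ)))

halfInterval : List ℕ → List ℕ → List (List ℕ)
halfInterval σ τ = filter (λ z → Data.Bool.T? (occursᵇ σ z)) (properPatterns τ)

sumℤ : List ℤ → ℤ
sumℤ = foldr ℤ._+_ (ℤ.+ 0)

-- Möbius function, by recursion on |τ| (fuel); μ(σ,σ)=1, μ(σ,τ) = -Σ_{σ≤z<τ} μ(σ,z)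
-- for σ < τ, and 0 when σ ≰ τ.
μ-fuel : ℕ → List ℕ → List ℕ → ℤ
μ-fuel zero σ τ = if does (≡-dec _≟_ σ τ) then ℤ.+ 1 else ℤ.+ 0
μ-fuel (suc n) σ τ =
  if does (≡-dec _≟_ σ τ) then ℤ.+ 1
  else (if occursᵇ σ τ then - sumℤ (map (μ-fuel n σ) (halfInterval σ τ)) else ℤ.+ 0)

μ : List ℕ → List ℕ → ℤ
μ σ τ = μ-fuel (length τ) σ τ

-- left tail of length i: a_{i+1} is the leftmost letter in any occurrence of σ
LeftTail : List ℕ → List ℕ → ℕ → Set
LeftTail σ τ i = OccursAt σ τ i × (∀ j → j < i → ¬ OccursAt σ τ j)

-- right tail of length j: a_{n-j} is the rightmost letter in any occurrence of σ
RightTail : List ℕ → List ℕ → ℕ → Set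
RightTail σ τ j = Data.Product.∃ λ p →
  (p + length σ + j ≡ length τ) × OccursAt σ τ p × (∀ q → p < q → ¬ OccursAt σ τ q)

suffixPattern : ℕ → List ℕ → List ℕ
suffixPattern k τ = std (drop (length τ ∸ k) τ)

Monotone : List ℕ → Set
Monotone p = (p ≡ map suc (upTo (length p))) ⊎ (p ≡ reverse (map suc (upTo (length p))))

module Submission where

-- Proposition 3.8.  We prove the stronger claim μ(σ,τ) ∈ {0, (-1)^(l+r)} by induction
-- on |τ|, which excludes (-1)^(l+r+1).  For σ < τ let A, B, C be the patterns of τ
-- without its last letter, its first letter, and both.  Every proper pattern of τ lies
-- below A or B; those below both are the ones below C and the "corrections": borders of τ
-- (both a prefix and a suffix pattern) not below C.  Inclusion–exclusion together with
-- Σ_{σ≤z≤w} μ(σ,z) = [σ = w] gives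
--   μ(σ,τ) = -([σ=A] + [σ=B] - [σ=C] - Σ_corrections μ(σ,z)).
-- When A ≠ B there is at most one correction z; the tails and the suffix pattern transfer
-- to it, so induction applies to μ(σ,z).  Two adjacent occurrences of a pattern ending at
-- the end of τ make the suffix of τ monotone: this rules out A = B and σ = A, and forces
-- tails (1,0) when σ = B and (1,1) when σ = C, where the formula gives -1 and 1.
-- Modules, in order: standardization, the pattern order, sums over patterns, the Möbius
-- recursion, monotone suffixes, borders, the decomposition, signs, the induction.

module Standardization where

  open import Defs
  open import Data.Nat using (ℕ; zero; suc; _+_; _≤_; _<_; _<ᵇ_; z≤n; s≤s)
  open import Data.Nat.Properties
  open import Data.Bool using (true; false)
  open import Data.List using (List; []; _∷_; length; map; take; drop)
  open import Data.List.Properties using (length-map; take-map; drop-map)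
  open import Data.List.Membership.Propositional using (_∈_)
  open import Data.List.Relation.Unary.Any using (here; there)
  open import Data.List.Relation.Unary.All using (All; []; _∷_)
  import Data.List.Relation.Unary.All as All
  open import Data.Product using (_×_; _,_)
  open import Data.Sum using (_⊎_; inj₁; inj₂)
  open import Data.Empty using (⊥-elim)
  open import Relation.Binary.PropositionalEquality

  length-std : ∀ w → length (std w) ≡ length w
  length-std w = length-map _ w

  length-factor : ∀ i k w → i + k ≤ length w → length (factor i k w) ≡ k
  length-factor zero    zero    w       _       = refl
  length-factor zero    (suc k) (x ∷ w) (s≤s p) = cong suc (length-factor zero k w p)
  length-factor (suc i) k       (x ∷ w) (s≤s p) = length-factor i k w p

  factor-[] : ∀ i k → factor i k [] ≡ []
  factor-[] zero    zero    = refl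
  factor-[] zero    (suc k) = refl
  factor-[] (suc i) zero    = refl
  factor-[] (suc i) (suc k) = refl

  factor-factor : ∀ i m j k w → i + m ≤ k → factor i m (factor j k w) ≡ factor (j + i) m w
  factor-factor i m j k [] _ =
    trans (cong (factor i m) (factor-[] j k)) (trans (factor-[] i m) (sym (factor-[] (j + i) m)))
  factor-factor i m (suc j) k (x ∷ w) p = factor-factor i m j k w p
  factor-factor zero zero zero k (x ∷ w) _ = refl
  factor-factor zero (suc m) zero (suc k) (x ∷ w) (s≤s p) = cong (x ∷_) (factor-factor zero m zero k w p)
  factor-factor (suc i) m zero (suc k) (x ∷ w) (s≤s p) = factor-factor i m zero k w p

  factor-map : ∀ (g : ℕ → ℕ) i k w → factor i k (map g w) ≡ map g (factor i k w)
  factor-map g i k w = trans (cong (take k) (drop-map i w)) (take-map k (drop i w))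

  ∈-factor : ∀ {x} i k w → x ∈ factor i k w → x ∈ w
  ∈-factor zero    (suc k) (y ∷ w) (here p)  = here p
  ∈-factor zero    (suc k) (y ∷ w) (there q) = there (∈-factor zero k w q)
  ∈-factor (suc i) k       (y ∷ w) q         = there (∈-factor i k w q)
  ∈-factor (suc i) zero    []      ()
  ∈-factor (suc i) (suc k) []      ()

  LettersOf : List ℕ → List ℕ → Set
  LettersOf w u = All (_∈ w) u

  letters-self : ∀ w → LettersOf w w
  letters-self []      = []
  letters-self (x ∷ w) = here refl ∷ All.map there (letters-self w)

  letters-factor : ∀ i k w → LettersOf w (factor i k w)
  letters-factor i k w = All.tabulate (∈-factor i k w)

  <ᵇ-view : ∀ a b → (a < b × (a <ᵇ b) ≡ true) ⊎ (b ≤ a × (a <ᵇ b) ≡ false)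
  <ᵇ-view zero    zero    = inj₂ (z≤n , refl)
  <ᵇ-view zero    (suc b) = inj₁ (s≤s z≤n , refl)
  <ᵇ-view (suc a) zero    = inj₂ (z≤n , refl)
  <ᵇ-view (suc a) (suc b) with <ᵇ-view a b
  ... | inj₁ (p , e) = inj₁ (s≤s p , e)
  ... | inj₂ (p , e) = inj₂ (s≤s p , e)

  <⇒<ᵇ≡true : ∀ {a b} → a < b → (a <ᵇ b) ≡ true
  <⇒<ᵇ≡true {a} {b} p with <ᵇ-view a b
  ... | inj₁ (_ , e) = e
  ... | inj₂ (q , _) = ⊥-elim (<⇒≱ p q)

  ≥⇒<ᵇ≡false : ∀ {a b} → b ≤ a → (a <ᵇ b) ≡ false
  ≥⇒<ᵇ≡false {a} {b} p with <ᵇ-view a b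
  ... | inj₁ (q , _) = ⊥-elim (<⇒≱ q p)
  ... | inj₂ (_ , e) = e

  countLess-mono : ∀ {a b} → a ≤ b → ∀ w → countLess a w ≤ countLess b w
  countLess-mono p [] = z≤n
  countLess-mono {a} {b} p (c ∷ w) with <ᵇ-view c a | <ᵇ-view c b
  ... | inj₁ (_ , e₁) | inj₁ (_ , e₂) rewrite e₁ | e₂ = s≤s (countLess-mono p w)
  ... | inj₁ (q , _)  | inj₂ (r , _)  = ⊥-elim (<⇒≱ (<-≤-trans q p) r)
  ... | inj₂ (_ , e₁) | inj₁ (_ , e₂) rewrite e₁ | e₂ = m≤n⇒m≤1+n (countLess-mono p w)
  ... | inj₂ (_ , e₁) | inj₂ (_ , e₂) rewrite e₁ | e₂ = countLess-mono p w

  countLess-strict : ∀ {a b} → a < b → ∀ w → a ∈ w → countLess a w < countLess b w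
  countLess-strict {a} {b} p (c ∷ w) (here refl)
    rewrite ≥⇒<ᵇ≡false {a} {a} ≤-refl | <⇒<ᵇ≡true p = s≤s (countLess-mono (<⇒≤ p) w)
  countLess-strict {a} {b} p (c ∷ w) (there q) with <ᵇ-view c a | <ᵇ-view c b
  ... | inj₁ (_ , e₁) | inj₁ (_ , e₂) rewrite e₁ | e₂ = s≤s (countLess-strict p w q)
  ... | inj₁ (r , _)  | inj₂ (t , _)  = ⊥-elim (<⇒≱ (<-trans r p) t)
  ... | inj₂ (_ , e₁) | inj₁ (_ , e₂) rewrite e₁ | e₂ = m≤n⇒m≤1+n (countLess-strict p w q)
  ... | inj₂ (_ , e₁) | inj₂ (_ , e₂) rewrite e₁ | e₂ = countLess-strict p w q

  -- The rank of a letter in w; by definition `std w ≡ map (rank w) w`.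
  rank : List ℕ → ℕ → ℕ
  rank w a = suc (countLess a w)

  rank-<ᵇ : ∀ w {a b} → a ∈ w → b ∈ w → (rank w b <ᵇ rank w a) ≡ (b <ᵇ a)
  rank-<ᵇ w {a} {b} ia ib with <ᵇ-view b a
  ... | inj₁ (p , e) rewrite e = <⇒<ᵇ≡true (s≤s (countLess-strict p w ib))
  ... | inj₂ (p , e) rewrite e with m≤n⇒m<n∨m≡n p
  ...   | inj₁ q    = ≥⇒<ᵇ≡false (<⇒≤ (s≤s (countLess-strict q w ia)))
  ...   | inj₂ refl = ≥⇒<ᵇ≡false {rank w a} ≤-refl

  countLess-rank : ∀ w {a} → a ∈ w → ∀ u → LettersOf w u →
    countLess (rank w a) (map (rank w) u) ≡ countLess a u
  countLess-rank w ia [] [] = refl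
  countLess-rank w {a} ia (b ∷ u) (ib ∷ us) rewrite rank-<ᵇ w ia ib with b <ᵇ a
  ... | true  = cong suc (countLess-rank w ia u us)
  ... | false = countLess-rank w ia u us

  std-rank : ∀ w u → LettersOf w u → std (map (rank w) u) ≡ std u
  std-rank w u us = go u us
    where
    go : ∀ v → LettersOf w v → map (rank (map (rank w) u)) (map (rank w) v) ≡ map (rank u) v
    go []      []        = refl
    go (b ∷ v) (ib ∷ vs) = cong₂ _∷_ (cong suc (countLess-rank w ib u us)) (go v vs)

  std-factor-std : ∀ i m w → std (factor i m (std w)) ≡ std (factor i m w)
  std-factor-std i m w =
    trans (cong std (factor-map (rank w) i m w)) (std-rank w (factor i m w) (letters-factor i m w))

  std-factor-factor : ∀ i m j k w → i + m ≤ k →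
    std (factor i m (std (factor j k w))) ≡ std (factor (j + i) m w)
  std-factor-factor i m j k w p =
    trans (std-factor-std i m (factor j k w)) (cong std (factor-factor i m j k w p))

  std-idem : ∀ w → std (std w) ≡ std w
  std-idem w = std-rank w w (letters-self w)

module PatternOrder where

  open import Defs
  open Standardization
  open import Data.Nat using (ℕ; zero; suc; _+_; _∸_; _≤_; _<_; s≤s; s≤s⁻¹)
  open import Data.Nat.Properties
  open import Data.Bool using (Bool; false; _∨_; T; T?)
  open import Data.Bool.Properties using (T-∨; T-∧)
  open import Data.List using (List; _∷_; length; map; take; upTo; foldr)
  open import Data.List.Properties using (≡-dec; take-all)
  open import Data.List.Membership.Propositional using (_∈_; lose; find)
  open import Data.List.Membership.Propositional.Properties
    using (∈-upTo⁺; ∈-upTo⁻; ∈-map⁺; ∈-map⁻; ∈-concatMap⁺; ∈-concatMap⁻;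
           ∈-filter⁺; ∈-filter⁻; ∈-deduplicate⁻; ∈-deduplicate⁺)
  open import Data.List.Relation.Unary.Any using (here; there)
  open import Data.List.Relation.Unary.Unique.Propositional using (Unique)
  import Data.List.Relation.Unary.Unique.DecPropositional.Properties as UniqueDec
  import Data.List.Relation.Unary.Unique.Propositional.Properties as Unique
  open import Data.Product using (_×_; _,_; proj₁; ∃)
  open import Data.Sum using (inj₁; inj₂)
  open import Data.Empty using (⊥-elim)
  open import Function.Bundles using (Equivalence)
  open import Relation.Nullary using (Dec; yes; no; does)
  open import Relation.Binary.PropositionalEquality

  open Equivalence using (to; from)

  occurrence-from-factor : ∀ σ w j k i → j + k ≤ length w → OccursAt σ (std (factor j k w)) i →
    (i + length σ ≤ k) × OccursAt σ w (j + i)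
  occurrence-from-factor σ w j k i jk (b , e) =
    inside ,
    ≤-trans (≤-reflexive (+-assoc j i (length σ))) (≤-trans (+-monoʳ-≤ j inside) jk) ,
    trans (sym (std-factor-factor i (length σ) j k w inside)) e
    where
    inside : i + length σ ≤ k
    inside = ≤-trans b (≤-reflexive (trans (length-std (factor j k w)) (length-factor j k w jk)))

  occurrence-in-factor : ∀ σ w j k i → j + k ≤ length w → i + length σ ≤ k →
    OccursAt σ w (j + i) → OccursAt σ (std (factor j k w)) i
  occurrence-in-factor σ w j k i jk b (_ , e) =
    ≤-trans b (≤-reflexive (sym (trans (length-std (factor j k w)) (length-factor j k w jk)))) ,
    trans (std-factor-factor i (length σ) j k w b) e

  -- An occurrence inside an occurrence: ≼ is transitive.
  ≼-trans : ∀ {σ z w} → σ ≼ z → z ≼ w → σ ≼ w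
  ≼-trans {σ} {z} {w} (i , oi) (j , (b , e))
    with occurrence-from-factor σ w j (length z) i b (subst (λ u → OccursAt σ u i) (sym e) oi)
  ... | _ , o = j + i , o

  factor-≼ : ∀ j k w → j + k ≤ length w → std (factor j k w) ≼ w
  factor-≼ j k w fits = j , subst (λ l → j + l ≤ length w) (sym lk) fits , cong (λ l → std (factor j l w)) lk
    where
    lk : length (std (factor j k w)) ≡ k
    lk = trans (length-std (factor j k w)) (length-factor j k w fits)

  ≼-length : ∀ {z w} → z ≼ w → length z ≤ length w
  ≼-length {z} (i , b , _) = ≤-trans (m≤n+m (length z) i) b

  ≼-std : ∀ {z w} → z ≼ w → std z ≡ z
  ≼-std (_ , _ , e) = trans (cong std (sym e)) (trans (std-idem _) e)

  ≼-refl : ∀ w → std w ≡ w → w ≼ w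
  ≼-refl w sw = 0 , ≤-refl , trans (cong std (take-all (length w) w ≤-refl)) sw

  ≼-same-length : ∀ {z w} → std w ≡ w → z ≼ w → length z ≡ length w → z ≡ w
  ≼-same-length {z} {w} sw (zero , _ , e) l =
    trans (sym e) (trans (cong (λ k → std (take k w)) l) (trans (cong std (take-all (length w) w ≤-refl)) sw))
  ≼-same-length {z} {w} sw (suc i , b , _) l =
    ⊥-elim (<⇒≱ (s≤s (m≤n+m (length w) i)) (subst (λ k → suc i + k ≤ length w) l b))

  does-sound : ∀ {A : Set} (d : Dec A) → T (does d) → A
  does-sound (yes a) _ = a

  does-complete : ∀ {A : Set} (d : Dec A) → A → T (does d)
  does-complete (yes _) _ = _
  does-complete (no ¬a) a = ¬a a

  occursAtᵇ-sound : ∀ σ τ i → T (occursAtᵇ σ τ i) → OccursAt σ τ i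
  occursAtᵇ-sound σ τ i t with to T-∧ t
  ... | t₁ , t₂ = ≤ᵇ⇒≤ (i + length σ) (length τ) t₁ , does-sound (≡-dec _≟_ _ σ) t₂

  occursAtᵇ-complete : ∀ σ τ i → OccursAt σ τ i → T (occursAtᵇ σ τ i)
  occursAtᵇ-complete σ τ i (b , e) = from T-∧ (≤⇒≤ᵇ b , does-complete (≡-dec _≟_ _ σ) e)

  some-sound : ∀ (f : ℕ → Bool) xs → T (foldr (λ i b → f i ∨ b) false xs) → ∃ λ i → i ∈ xs × T (f i)
  some-sound f (x ∷ xs) t with to (T-∨ {f x}) t
  ... | inj₁ p = x , here refl , p
  ... | inj₂ p with some-sound f xs p
  ...   | i , m , q = i , there m , q

  some-complete : ∀ (f : ℕ → Bool) xs i → i ∈ xs → T (f i) → T (foldr (λ i b → f i ∨ b) false xs)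
  some-complete f (x ∷ xs) i (here refl) p = from (T-∨ {f x}) (inj₁ p)
  some-complete f (x ∷ xs) i (there m)   p = from (T-∨ {f x}) (inj₂ (some-complete f xs i m p))

  occursᵇ-sound : ∀ σ τ → T (occursᵇ σ τ) → σ ≼ τ
  occursᵇ-sound σ τ t with some-sound (occursAtᵇ σ τ) (upTo (suc (length τ))) t
  ... | i , _ , p = i , occursAtᵇ-sound σ τ i p

  occursᵇ-complete : ∀ σ τ → σ ≼ τ → T (occursᵇ σ τ)
  occursᵇ-complete σ τ (i , o) = some-complete (occursAtᵇ σ τ) (upTo (suc (length τ))) i
    (∈-upTo⁺ (s≤s (≤-trans (m≤m+n i (length σ)) (proj₁ o)))) (occursAtᵇ-complete σ τ i o)

  private
    patternsOfLength : List ℕ → ℕ → List (List ℕ)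
    patternsOfLength τ k = map (λ i → std (factor i k τ)) (upTo (suc (length τ ∸ k)))

  properPatterns-sound : ∀ τ z → z ∈ properPatterns τ → z ≼ τ × length z < length τ
  properPatterns-sound τ z m
    with find (∈-concatMap⁻ (patternsOfLength τ) {xs = upTo (length τ)} (∈-deduplicate⁻ (≡-dec _≟_) _ m))
  ... | k , k∈ , z∈ with ∈-map⁻ (λ i → std (factor i k τ)) z∈
  ...   | i , i∈ , refl = (i , subst (λ l → i + l ≤ length τ) (sym lz) ik , cong (λ l → std (factor i l τ)) lz) ,
                           subst (_< length τ) (sym lz) k<n
    where
    k<n : k < length τ
    k<n = ∈-upTo⁻ k∈
    ik : i + k ≤ length τ
    ik = ≤-trans (+-monoˡ-≤ k (s≤s⁻¹ (∈-upTo⁻ i∈))) (≤-reflexive (m∸n+n≡m (<⇒≤ k<n)))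
    lz : length (std (factor i k τ)) ≡ k
    lz = trans (length-std (factor i k τ)) (length-factor i k τ ik)

  properPatterns-complete : ∀ τ z → z ≼ τ → length z < length τ → z ∈ properPatterns τ
  properPatterns-complete τ z (i , b , e) lt = ∈-deduplicate⁺ (≡-dec _≟_)
    (∈-concatMap⁺ (patternsOfLength τ) {xs = upTo (length τ)}
      (lose (∈-upTo⁺ lt) (subst (_∈ patternsOfLength τ (length z)) e
        (∈-map⁺ (λ i → std (factor i (length z) τ)) (∈-upTo⁺ (s≤s i≤n∸k))))))
    where
    i≤n∸k : i ≤ length τ ∸ length z
    i≤n∸k = ≤-trans (≤-reflexive (sym (m+n∸n≡m i (length z)))) (∸-monoˡ-≤ (length z) b)

  properPatterns-unique : ∀ τ → Unique (properPatterns τ)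
  properPatterns-unique τ = UniqueDec.deduplicate-! (≡-dec _≟_) _

  halfInterval-sound : ∀ σ τ z → z ∈ halfInterval σ τ → σ ≼ z × z ≼ τ × length z < length τ
  halfInterval-sound σ τ z m with ∈-filter⁻ (λ z → T? (occursᵇ σ z)) {xs = properPatterns τ} m
  ... | m′ , t with properPatterns-sound τ z m′
  ...   | zτ , lt = occursᵇ-sound σ z t , zτ , lt

  halfInterval-complete : ∀ σ τ z → σ ≼ z → z ≼ τ → length z < length τ → z ∈ halfInterval σ τ
  halfInterval-complete σ τ z σz zτ lt = ∈-filter⁺ (λ z → T? (occursᵇ σ z)) {xs = properPatterns τ}
    (properPatterns-complete τ z zτ lt) (occursᵇ-complete σ z σz)

  halfInterval-unique : ∀ σ τ → Unique (halfInterval σ τ)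
  halfInterval-unique σ τ = Unique.filter⁺ (λ z → T? (occursᵇ σ z)) (properPatterns-unique τ)

module PatternSums where

  open import Defs using (sumℤ)
  open import Data.Nat using (ℕ)
  open import Data.Bool using (Bool; true; false; if_then_else_; T; T?; _∧_; _∨_; not)
  open import Data.Unit using (tt)
  open import Data.Sum using (_⊎_; inj₁; inj₂)
  open import Data.Product using (_×_; _,_; proj₁; proj₂; ∃)
  open import Data.List using (List; []; _∷_; map; filter; _++_)
  open import Data.List.Membership.Propositional using (_∈_)
  open import Data.List.Membership.Propositional.Properties.WithK using (unique∧set⇒bag)
  open import Data.List.Relation.Binary.BagAndSetEquality using (∼bag⇒↭)
  open import Data.List.Relation.Binary.Permutation.Propositional using (_↭_; refl; prep; swap; trans)
  open import Data.List.Relation.Unary.Any using (here; there)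
  open import Data.List.Relation.Unary.All using (All; []; _∷_)
  import Data.List.Relation.Unary.All as All
  import Data.List.Relation.Unary.AllPairs as AllPairs
  open import Data.List.Relation.Unary.Unique.Propositional using (Unique)
  open import Data.Empty using (⊥; ⊥-elim)
  open import Data.Integer using (ℤ; +_; -_; _+_; _-_)
  open import Data.Integer.Properties using (+-comm; +-assoc; +-identityˡ; +-identityʳ; neg-distrib-+)
  open import Data.Integer.Solver using (module +-*-Solver)
  open import Function.Bundles using (mk⇔)
  open import Relation.Binary.PropositionalEquality as ≡ using (_≡_; cong; cong₂; sym)

  open +-*-Solver

  sumOver : (List ℕ → ℤ) → List (List ℕ) → ℤ
  sumOver f U = sumℤ (map f U)

  sumOver-↭ : ∀ f {xs ys} → xs ↭ ys → sumOver f xs ≡ sumOver f ys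
  sumOver-↭ f refl        = ≡.refl
  sumOver-↭ f (prep x p)  = cong (_+_ (f x)) (sumOver-↭ f p)
  sumOver-↭ f (swap {xs = xs} {ys = ys} x y p) =
    ≡.trans (sym (+-assoc (f x) (f y) (sumOver f xs)))
      (≡.trans (cong₂ _+_ (+-comm (f x) (f y)) (sumOver-↭ f p)) (+-assoc (f y) (f x) (sumOver f ys)))
  sumOver-↭ f (trans p q) = ≡.trans (sumOver-↭ f p) (sumOver-↭ f q)

  sumOver-sameMembers : ∀ f {xs ys} → Unique xs → Unique ys →
    (∀ z → z ∈ xs → z ∈ ys) → (∀ z → z ∈ ys → z ∈ xs) → sumOver f xs ≡ sumOver f ys
  sumOver-sameMembers f ux uy to from =
    sumOver-↭ f (∼bag⇒↭ (unique∧set⇒bag ux uy (λ {z} → mk⇔ (to z) (from z))))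

  sumOver-empty : ∀ f (U : List (List ℕ)) → (∀ z → z ∈ U → ⊥) → sumOver f U ≡ + 0
  sumOver-empty f []      _     = ≡.refl
  sumOver-empty f (x ∷ U) empty = ⊥-elim (empty x (here ≡.refl))

  sumOver-cong : ∀ f g U → All (λ z → f z ≡ g z) U → sumOver f U ≡ sumOver g U
  sumOver-cong f g []      []       = ≡.refl
  sumOver-cong f g (x ∷ U) (e ∷ es) = cong₂ _+_ e (sumOver-cong f g U es)

  sumOver-+ : ∀ f g U → sumOver (λ z → f z + g z) U ≡ sumOver f U + sumOver g U
  sumOver-+ f g []      = ≡.refl
  sumOver-+ f g (x ∷ U) rewrite sumOver-+ f g U =
    solve 4 (λ a b c d → (a :+ b) :+ (c :+ d) := (a :+ c) :+ (b :+ d)) ≡.refl (f x) (g x) (sumOver f U) (sumOver g U)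

  sumOver-neg : ∀ f U → sumOver (λ z → - f z) U ≡ - sumOver f U
  sumOver-neg f []      = ≡.refl
  sumOver-neg f (x ∷ U) = ≡.trans (cong (_+_ (- f x)) (sumOver-neg f U)) (sym (neg-distrib-+ (f x) (sumOver f U)))

  sumOver-- : ∀ f g U → sumOver (λ z → f z - g z) U ≡ sumOver f U - sumOver g U
  sumOver-- f g U = ≡.trans (sumOver-+ f (λ z → - g z) U) (cong (_+_ (sumOver f U)) (sumOver-neg g U))

  sumOver-++ : ∀ f xs ys → sumOver f (xs ++ ys) ≡ sumOver f xs + sumOver f ys
  sumOver-++ f []       ys = sym (+-identityˡ _)
  sumOver-++ f (x ∷ xs) ys rewrite sumOver-++ f xs ys = sym (+-assoc (f x) (sumOver f xs) (sumOver f ys))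

  restrict : Bool → ℤ → ℤ
  restrict b v = if b then v else + 0

  sumOver-filter : ∀ f (P : List ℕ → Bool) U →
    sumOver f (filter (λ z → T? (P z)) U) ≡ sumOver (λ z → restrict (P z) (f z)) U
  sumOver-filter f P [] = ≡.refl
  sumOver-filter f P (x ∷ U) with P x
  ... | true  = cong (_+_ (f x)) (sumOver-filter f P U)
  ... | false = ≡.trans (sumOver-filter f P U) (sym (+-identityˡ _))

  -- Pointwise inclusion–exclusion: for z in [σ,τ) (indicator s) lying below A or B
  -- (indicators a, b), with "below C" (indicator c) implying "below A and below B".
  restrict-split : ∀ s a b c v → T (a ∨ b) → (T c → T a × T b) →
    restrict s v ≡ restrict (s ∧ a) v + restrict (s ∧ b) v - (restrict (s ∧ c) v + restrict (((s ∧ a) ∧ b) ∧ not c) v)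
  restrict-split false a     b     c     v _ _    = ≡.refl
  restrict-split true  false b     true  v _ c⇒ab = ⊥-elim (proj₁ (c⇒ab tt))
  restrict-split true  true  false true  v _ c⇒ab = ⊥-elim (proj₂ (c⇒ab tt))
  restrict-split true  true  true  true  v _ _    = solve 1 (λ v → v := v :+ v :- (v :+ con (+ 0))) ≡.refl v
  restrict-split true  true  true  false v _ _    = solve 1 (λ v → v := v :+ v :- (con (+ 0) :+ v)) ≡.refl v
  restrict-split true  true  false false v _ _    = solve 1 (λ v → v := v :+ con (+ 0) :- (con (+ 0) :+ con (+ 0))) ≡.refl v
  restrict-split true  false true  false v _ _    = solve 1 (λ v → v := con (+ 0) :+ v :- (con (+ 0) :+ con (+ 0))) ≡.refl v

  sumOver-subsingleton : ∀ f L → Unique L → (∀ x y → x ∈ L → y ∈ L → x ≡ y) →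
    sumOver f L ≡ + 0 ⊎ ∃ λ x → x ∈ L × sumOver f L ≡ f x
  sumOver-subsingleton f []          _ _   = inj₁ ≡.refl
  sumOver-subsingleton f (x ∷ [])    _ _   = inj₂ (x , here ≡.refl , +-identityʳ (f x))
  sumOver-subsingleton f (x ∷ y ∷ L) ((x≢y All.∷ _) AllPairs.∷ _) one =
    ⊥-elim (x≢y (one x y (here ≡.refl) (there (here ≡.refl))))

module Mobius where

  open import Defs
  open PatternOrder
  open PatternSums
  open import Data.Nat using (ℕ; zero; suc; _≤_; _<_; s≤s⁻¹)
  open import Data.Nat.Properties using (≤-trans; <-≤-trans; ≤-refl; <-irrefl; ≤-antisym; _≟_; m≤n⇒m<n∨m≡n)
  open import Data.Bool using (Bool; true; false; T; T?; _∧_)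
  open import Data.Bool.Properties using (T-∧)
  open import Data.List using (List; []; _∷_; filter; _++_; length)
  open import Data.List.Properties using (≡-dec)
  open import Data.List.Membership.Propositional using (_∈_)
  open import Data.List.Membership.Propositional.Properties using (∈-filter⁺; ∈-filter⁻; ∈-++⁺ˡ; ∈-++⁺ʳ; ∈-++⁻)
  open import Data.List.Relation.Unary.Any using (here)
  import Data.List.Relation.Unary.All as All
  import Data.List.Relation.Unary.AllPairs as AllPairs
  open import Data.List.Relation.Unary.Unique.Propositional using (Unique)
  import Data.List.Relation.Unary.Unique.Propositional.Properties as Unique
  open import Data.Integer using (+_; -_; _+_; _-_)
  open import Data.Integer.Properties using (+-identityʳ; +-inverseʳ)
  open import Data.Product using (_×_; _,_; proj₂)
  open import Data.Sum using (inj₁; inj₂)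
  open import Data.Empty using (⊥-elim)
  open import Function.Bundles using (Equivalence)
  open import Relation.Nullary using (¬_; yes; no; does)
  open import Relation.Binary.PropositionalEquality as ≡ using (_≡_; cong; sym; subst)

  open Equivalence using (to; from)

  μ-fuel-stable : ∀ k j σ τ → length τ ≤ k → length τ ≤ j → μ-fuel k σ τ ≡ μ-fuel j σ τ
  μ-fuel-stable zero zero σ τ _ _ = ≡.refl
  μ-fuel-stable zero (suc j) σ [] _ _ with does (≡-dec _≟_ σ [])
  ... | true = ≡.refl
  ... | false with occursᵇ σ []
  ...   | true  = ≡.refl
  ...   | false = ≡.refl
  μ-fuel-stable (suc k) zero σ [] _ _ with does (≡-dec _≟_ σ [])
  ... | true = ≡.refl
  ... | false with occursᵇ σ []
  ...   | true  = ≡.refl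
  ...   | false = ≡.refl
  μ-fuel-stable (suc k) (suc j) σ τ a b with does (≡-dec _≟_ σ τ)
  ... | true = ≡.refl
  ... | false with occursᵇ σ τ
  ...   | false = ≡.refl
  ...   | true  = cong -_ (sumOver-cong (μ-fuel k σ) (μ-fuel j σ) (halfInterval σ τ) (All.tabulate λ {z} m →
            let z<τ = proj₂ (proj₂ (halfInterval-sound σ τ z m)) in
            μ-fuel-stable k j σ z (s≤s⁻¹ (≤-trans z<τ a)) (s≤s⁻¹ (≤-trans z<τ b))))

  μ-refl : ∀ σ → μ σ σ ≡ + 1
  μ-refl σ = any-fuel (length σ)
    where
    any-fuel : ∀ k → μ-fuel k σ σ ≡ + 1
    any-fuel zero with ≡-dec _≟_ σ σ
    ... | yes _  = ≡.refl
    ... | no σ≢σ = ⊥-elim (σ≢σ ≡.refl)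
    any-fuel (suc k) with ≡-dec _≟_ σ σ
    ... | yes _  = ≡.refl
    ... | no σ≢σ = ⊥-elim (σ≢σ ≡.refl)

  μ-unfold : ∀ σ τ → ¬ (σ ≡ τ) → σ ≼ τ → μ σ τ ≡ - sumOver (μ σ) (halfInterval σ τ)
  μ-unfold σ [] σ≢τ σ≼τ with ≼-length σ≼τ
  μ-unfold []      [] σ≢τ _ | _ = ⊥-elim (σ≢τ ≡.refl)
  μ-unfold (_ ∷ _) [] _   _ | ()
  μ-unfold σ τ@(_ ∷ τ′) σ≢τ σ≼τ with ≡-dec _≟_ σ τ | occursᵇ σ τ | occursᵇ-complete σ τ σ≼τ
  ... | yes σ≡τ | _    | _ = ⊥-elim (σ≢τ σ≡τ)
  ... | no _    | true | _ = cong -_ (sumOver-cong (μ-fuel (length τ′) σ) (μ σ) (halfInterval σ τ) (All.tabulate λ {z} m →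
            μ-fuel-stable (length τ′) (length z) σ z (s≤s⁻¹ (proj₂ (proj₂ (halfInterval-sound σ τ z m)))) ≤-refl))

  -- If τ is no longer than σ, the interval [σ, τ) is empty.
  μ-no-longer : ∀ σ τ → ¬ (σ ≡ τ) → σ ≼ τ → length τ ≤ length σ → μ σ τ ≡ + 0
  μ-no-longer σ τ σ≢τ σ≼τ τ≤σ = ≡.trans (μ-unfold σ τ σ≢τ σ≼τ) (cong -_ (sumOver-empty (μ σ) (halfInterval σ τ) λ z m →
    let (σ≼z , _ , z<τ) = halfInterval-sound σ τ z m in
    <-irrefl ≡.refl (<-≤-trans z<τ (≤-trans τ≤σ (≼-length σ≼z)))))

  inInterval : List ℕ → List ℕ → List ℕ → Bool
  inInterval σ w z = occursᵇ σ z ∧ occursᵇ z w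

  interval : List ℕ → List ℕ → List (List ℕ) → List (List ℕ)
  interval σ w U = filter (λ z → T? (inInterval σ w z)) U

  interval-sound : ∀ σ w U z → z ∈ interval σ w U → z ∈ U × σ ≼ z × z ≼ w
  interval-sound σ w U z m with ∈-filter⁻ (λ z → T? (inInterval σ w z)) {xs = U} m
  ... | z∈U , t with to T-∧ t
  ...   | t₁ , t₂ = z∈U , occursᵇ-sound σ z t₁ , occursᵇ-sound z w t₂

  interval-complete : ∀ σ w U z → z ∈ U → σ ≼ z → z ≼ w → z ∈ interval σ w U
  interval-complete σ w U z z∈U σz zw =
    ∈-filter⁺ (λ z → T? (inInterval σ w z)) {xs = U} z∈U (from T-∧ (occursᵇ-complete σ z σz , occursᵇ-complete z w zw))

  -- Σ_{σ ≤ z ≤ w} μ(σ, z) = [σ = w], when U contains all patterns of w: for σ < w the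
  -- interval is [σ, w) ⊎ {w}, and the recursion for μ(σ, w) cancels the sum.
  private
    singleton-unique : ∀ (x : List ℕ) → Unique (x ∷ [])
    singleton-unique x = All.[] AllPairs.∷ AllPairs.[]

  interval-sum-≢ : ∀ σ w U → std w ≡ w → Unique U → (∀ z → z ≼ w → z ∈ U) → ¬ (σ ≡ w) →
    sumOver (μ σ) (interval σ w U) ≡ + 0
  interval-sum-≢ σ w U sw uU cover σ≢w with occursᵇ σ w in eq
  ... | false = sumOver-empty (μ σ) (interval σ w U) λ z m →
    let (_ , σz , zw) = interval-sound σ w U z m in subst T eq (occursᵇ-complete σ w (≼-trans σz zw))
  ... | true = begin
    sumOver (μ σ) (interval σ w U)                              ≡⟨ sumOver-sameMembers (μ σ) uI uH to′ from′ ⟩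
    sumOver (μ σ) (halfInterval σ w ++ w ∷ [])                  ≡⟨ sumOver-++ (μ σ) (halfInterval σ w) (w ∷ []) ⟩
    sumOver (μ σ) (halfInterval σ w) + (μ σ w + + 0)            ≡⟨ cong (_+_ (sumOver (μ σ) (halfInterval σ w))) (+-identityʳ (μ σ w)) ⟩
    sumOver (μ σ) (halfInterval σ w) + μ σ w                    ≡⟨ cong (_+_ (sumOver (μ σ) (halfInterval σ w))) (μ-unfold σ w σ≢w σw) ⟩
    sumOver (μ σ) (halfInterval σ w) - sumOver (μ σ) (halfInterval σ w) ≡⟨ +-inverseʳ (sumOver (μ σ) (halfInterval σ w)) ⟩
    + 0 ∎
    where
    open ≡.≡-Reasoning
    σw : σ ≼ w
    σw = occursᵇ-sound σ w (subst T (sym eq) _)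
    uI : Unique (interval σ w U)
    uI = Unique.filter⁺ (λ z → T? (inInterval σ w z)) uU
    uH : Unique (halfInterval σ w ++ w ∷ [])
    uH = Unique.++⁺ (halfInterval-unique σ w) (singleton-unique w)
           λ { (m , here ≡.refl) → <-irrefl ≡.refl (proj₂ (proj₂ (halfInterval-sound σ w w m))) }
    to′ : ∀ z → z ∈ interval σ w U → z ∈ halfInterval σ w ++ w ∷ []
    to′ z m with interval-sound σ w U z m
    ... | _ , σz , zw with m≤n⇒m<n∨m≡n (≼-length zw)
    ...   | inj₁ lt = ∈-++⁺ˡ (halfInterval-complete σ w z σz zw lt)
    ...   | inj₂ le = ∈-++⁺ʳ (halfInterval σ w) (here (≼-same-length sw zw le))
    from′ : ∀ z → z ∈ halfInterval σ w ++ w ∷ [] → z ∈ interval σ w U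
    from′ z m with ∈-++⁻ (halfInterval σ w) m
    ... | inj₁ m′ = let (σz , zw , _) = halfInterval-sound σ w z m′ in interval-complete σ w U z (cover z zw) σz zw
    ... | inj₂ (here ≡.refl) = interval-complete σ w U w (cover w (≼-refl w sw)) σw (≼-refl w sw)

  interval-sum-≡ : ∀ σ U → std σ ≡ σ → Unique U → (∀ z → z ≼ σ → z ∈ U) → sumOver (μ σ) (interval σ σ U) ≡ + 1
  interval-sum-≡ σ U sσ uU cover = begin
    sumOver (μ σ) (interval σ σ U) ≡⟨ sumOver-sameMembers (μ σ) (Unique.filter⁺ (λ z → T? (inInterval σ σ z)) uU)
                                        (singleton-unique σ) to′ from′ ⟩
    μ σ σ + + 0                    ≡⟨ +-identityʳ (μ σ σ) ⟩
    μ σ σ                          ≡⟨ μ-refl σ ⟩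
    + 1                            ∎
    where
    open ≡.≡-Reasoning
    to′ : ∀ z → z ∈ interval σ σ U → z ∈ σ ∷ []
    to′ z m with interval-sound σ σ U z m
    ... | _ , σz , zσ = here (≼-same-length sσ zσ (≤-antisym (≼-length zσ) (≼-length σz)))
    from′ : ∀ z → z ∈ σ ∷ [] → z ∈ interval σ σ U
    from′ z (here ≡.refl) = interval-complete σ σ U σ (cover σ (≼-refl σ sσ)) (≼-refl σ sσ) (≼-refl σ sσ)

module MonotoneSuffix where

  open import Defs
  open Standardization
  open import Data.Nat using (ℕ; zero; suc; _+_; _∸_; _≤_; _<_; _<ᵇ_)
  open import Data.Nat.Properties
  open import Data.Bool using (Bool; true; false; T)
  open import Data.Unit using (⊤; tt)
  open import Data.List using (List; []; _∷_; map; length; take; drop; upTo; reverse)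
  open import Data.List.Properties using (∷-injective; map-upTo; upTo-∷ʳ; map-++; reverse-++; take-all; length-drop; drop-drop)
  open import Data.List.Relation.Unary.All using (All; []; _∷_)
  import Data.List.Relation.Unary.All as All
  open import Data.List.Relation.Unary.Unique.Propositional using (Unique)
  import Data.List.Relation.Unary.Unique.Propositional.Properties as Unique
  import Data.List.Relation.Unary.AllPairs as AllPairs
  open import Data.Product using (_×_; _,_; ∃)
  open import Data.Sum using (inj₁; inj₂)
  open import Data.Empty using (⊥-elim)
  open import Relation.Binary.PropositionalEquality

  steps : List ℕ → List Bool
  steps (a ∷ b ∷ w) = (a <ᵇ b) ∷ steps (b ∷ w)
  steps _           = []

  steps-rank : ∀ w v → LettersOf w v → steps (map (rank w) v) ≡ steps v
  steps-rank w []          _              = refl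
  steps-rank w (a ∷ [])    _              = refl
  steps-rank w (a ∷ b ∷ v) (ia ∷ ib ∷ vs) = cong₂ _∷_ (rank-<ᵇ w ib ia) (steps-rank w (b ∷ v) (ib ∷ vs))

  steps-std : ∀ w → steps (std w) ≡ steps w
  steps-std w = steps-rank w w (letters-self w)

  Steady : Bool → List ℕ → Set
  Steady c (a ∷ b ∷ w) = (a <ᵇ b) ≡ c × Steady c (b ∷ w)
  Steady c _           = ⊤

  Steady-tail : ∀ c a w → Steady c (a ∷ w) → Steady c w
  Steady-tail c a []      _       = tt
  Steady-tail c a (b ∷ w) (_ , h) = h

  Steady-drop : ∀ c j u → Steady c u → Steady c (drop j u)
  Steady-drop c zero    u           h       = h
  Steady-drop c (suc j) []          _       = tt
  Steady-drop c (suc j) (a ∷ [])    _       = Steady-drop c j [] tt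
  Steady-drop c (suc j) (a ∷ b ∷ u) (_ , h) = Steady-drop c j (b ∷ u) h

  dropLast : List ℕ → List ℕ
  dropLast []          = []
  dropLast (a ∷ [])    = []
  dropLast (a ∷ b ∷ w) = a ∷ dropLast (b ∷ w)

  take-dropLast : ∀ m u → length u ≡ suc m → take m u ≡ dropLast u
  take-dropLast zero    (a ∷ [])    _ = refl
  take-dropLast (suc m) (a ∷ b ∷ u) e = cong (a ∷_) (take-dropLast m (b ∷ u) (suc-injective e))

  shift-invariant⇒steady : ∀ u → steps (dropLast u) ≡ steps (drop 1 u) → ∃ λ c → Steady c u
  shift-invariant⇒steady []          _ = true , tt
  shift-invariant⇒steady (a ∷ [])    _ = true , tt
  shift-invariant⇒steady (a ∷ b ∷ w) e = (a <ᵇ b) , go a b w e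
    where
    go : ∀ a b w → steps (dropLast (a ∷ b ∷ w)) ≡ steps (b ∷ w) → Steady (a <ᵇ b) (a ∷ b ∷ w)
    go a b []      _ = refl , tt
    go a b (c ∷ w) e with ∷-injective e
    ... | a<ᵇb≡b<ᵇc , rest = refl , subst (λ x → Steady x (b ∷ c ∷ w)) (sym a<ᵇb≡b<ᵇc) (go b c w rest)

  private
    increasing-after : ∀ a w → Steady true (a ∷ w) → All (a <_) w
    increasing-after a []      _       = []
    increasing-after a (b ∷ w) (e , h) = a<b ∷ All.map (<-trans a<b) (increasing-after b w h)
      where
      a<b : a < b
      a<b = <ᵇ⇒< a b (subst T (sym e) tt)

    decreasing-after : ∀ a w → Steady false (a ∷ w) → Unique (a ∷ w) → All (_< a) w
    decreasing-after a []      _       _ = []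
    decreasing-after a (b ∷ w) (e , h) ((a≢b ∷ _) AllPairs.∷ u) =
      b<a ∷ All.map (λ p → <-trans p b<a) (decreasing-after b w h u)
      where
      b<a : b < a
      b<a with <ᵇ-view a b
      ... | inj₁ (_ , e′)  = ⊥-elim (true≢false (trans (sym e′) e))
        where
        true≢false : true ≢ false
        true≢false ()
      ... | inj₂ (b≤a , _) = ≤∧≢⇒< b≤a (λ b≡a → a≢b (sym b≡a))

    countLess-above : ∀ a w → All (a <_) w → countLess a w ≡ 0
    countLess-above a []      []       = refl
    countLess-above a (b ∷ w) (p ∷ ps) rewrite ≥⇒<ᵇ≡false {b} {a} (<⇒≤ p) = countLess-above a w ps

    countLess-below : ∀ a w → All (_< a) w → countLess a w ≡ length w
    countLess-below a []      []       = refl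
    countLess-below a (b ∷ w) (p ∷ ps) rewrite <⇒<ᵇ≡true p = cong suc (countLess-below a w ps)

  std-increasing : ∀ u → Steady true u → std u ≡ map suc (upTo (length u))
  std-increasing []      _ = refl
  std-increasing (a ∷ w) h rewrite ≥⇒<ᵇ≡false {a} {a} ≤-refl =
    cong₂ _∷_ (cong suc (countLess-above a w (increasing-after a w h)))
      (trans (ranks (increasing-after a w h))
        (trans (cong (map suc) (std-increasing w (Steady-tail true a w h))) (cong (map suc) (map-upTo suc (length w)))))
    where
    ranks : ∀ {v} → All (a <_) v → map (rank (a ∷ w)) v ≡ map suc (map (rank w) v)
    ranks []                     = refl
    ranks {x ∷ _} (p ∷ ps) rewrite <⇒<ᵇ≡true p = cong (_ ∷_) (ranks ps)

  reverse-upTo : ∀ L → reverse (map suc (upTo (suc L))) ≡ suc L ∷ reverse (map suc (upTo L))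
  reverse-upTo L = trans (cong (λ xs → reverse (map suc xs)) (sym (upTo-∷ʳ L)))
    (trans (cong reverse (map-++ suc (upTo L) (L ∷ []))) (reverse-++ (map suc (upTo L)) (suc L ∷ [])))

  std-decreasing : ∀ u → Steady false u → Unique u → std u ≡ reverse (map suc (upTo (length u)))
  std-decreasing []      _ _ = refl
  std-decreasing (a ∷ w) h u@(_ AllPairs.∷ uw) rewrite ≥⇒<ᵇ≡false {a} {a} ≤-refl =
    trans (cong₂ _∷_ (cong suc (countLess-below a w (decreasing-after a w h u)))
                     (trans (ranks (decreasing-after a w h u)) (std-decreasing w (Steady-tail false a w h) uw)))
          (sym (reverse-upTo (length w)))
    where
    ranks : ∀ {v} → All (_< a) v → map (rank (a ∷ w)) v ≡ map (rank w) v
    ranks []                     = refl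
    ranks {x ∷ _} (p ∷ ps) rewrite ≥⇒<ᵇ≡false {a} {x} (<⇒≤ p) = cong (_ ∷_) (ranks ps)

  steady⇒monotone : ∀ c u → Steady c u → Unique u → Monotone (std u)
  steady⇒monotone true  u h _  = inj₁ (trans (std-increasing u h) (cong (λ l → map suc (upTo l)) (sym (length-std u))))
  steady⇒monotone false u h uu = inj₂ (trans (std-decreasing u h uu) (cong (λ l → reverse (map suc (upTo l))) (sym (length-std u))))

  -- Two occurrences of σ at adjacent positions p, p+1, the second one ending at the end
  -- of τ, force the up/down word of τ from position p on to be constant; hence every
  -- suffix of τ starting at or after p has a monotone pattern.
  adjacent-occurrences⇒monotone : ∀ σ τ p → OccursAt σ τ p → OccursAt σ τ (suc p) →
    suc p + length σ ≡ length τ → Unique τ → ∀ j → p ≤ j → Monotone (std (drop j τ))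
  adjacent-occurrences⇒monotone σ τ p (_ , e₁) (_ , e₂) e uτ j p≤j
    with shift-invariant⇒steady (drop p τ) shift-invariant
    where
    m = length σ
    length-from-p : length (drop p τ) ≡ suc m
    length-from-p = trans (length-drop p τ) (trans (cong (_∸ p) (sym (trans (+-suc p m) e))) (m+n∸m≡n p (suc m)))
    length-after-p : length (drop (suc p) τ) ≡ m
    length-after-p = trans (length-drop (suc p) τ) (trans (cong (_∸ suc p) (sym e)) (m+n∸m≡n (suc p) m))
    shift-invariant : steps (dropLast (drop p τ)) ≡ steps (drop 1 (drop p τ))
    shift-invariant = begin
      steps (dropLast (drop p τ))      ≡⟨ cong steps (sym (take-dropLast m (drop p τ) length-from-p)) ⟩
      steps (factor p m τ)             ≡⟨ sym (steps-std (factor p m τ)) ⟩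
      steps (std (factor p m τ))       ≡⟨ cong steps (trans e₁ (sym e₂)) ⟩
      steps (std (factor (suc p) m τ)) ≡⟨ steps-std (factor (suc p) m τ) ⟩
      steps (factor (suc p) m τ)       ≡⟨ cong steps (take-all m (drop (suc p) τ) (≤-reflexive length-after-p)) ⟩
      steps (drop (suc p) τ)           ≡⟨ cong steps (trans (cong (λ q → drop q τ) (+-comm 1 p)) (sym (drop-drop p 1 τ))) ⟩
      steps (drop 1 (drop p τ))        ∎
      where open ≡-Reasoning
  ... | c , steady = subst (λ v → Monotone (std v)) (trans (drop-drop p (j ∸ p) τ) (cong (λ q → drop q τ) (m+[n∸m]≡n p≤j)))
    (steady⇒monotone c (drop (j ∸ p) (drop p τ)) (Steady-drop c (j ∸ p) (drop p τ) steady)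
      (Unique.drop⁺ (j ∸ p) (Unique.drop⁺ p uτ)))

module Borders where

  open import Defs
  open Standardization
  open PatternOrder
  open import Data.Nat using (ℕ; _+_; _∸_; _≤_; _<_)
  open import Data.Nat.Properties
  open import Data.List using (List; []; _∷_; map; length; drop)
  open import Data.List.Properties using (take-all; length-drop)
  open import Data.List.Membership.Propositional using (_∈_)
  open import Data.List.Relation.Unary.All using (All; []; _∷_)
  open import Data.List.Relation.Unary.Unique.Propositional using (Unique)
  import Data.List.Relation.Unary.Unique.Propositional.Properties as Unique
  import Data.List.Relation.Unary.AllPairs as AllPairs
  open import Data.List.Relation.Binary.Permutation.Propositional using (_↭_; refl; prep; swap; trans; ↭-sym)
  open import Data.List.Relation.Binary.Permutation.Propositional.Properties using (All-resp-↭)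
  open import Data.Product using (_×_; _,_; proj₂)
  open import Data.Empty using (⊥-elim)
  open import Relation.Nullary using (yes; no)
  open import Relation.Binary.Definitions using (tri<; tri≈; tri>)
  open import Relation.Binary.PropositionalEquality as ≡ using (_≡_; _≢_; cong; sym; subst)

  unique-↭ : ∀ {xs ys : List ℕ} → xs ↭ ys → Unique xs → Unique ys
  unique-↭ refl          u = u
  unique-↭ (prep x p)    (h AllPairs.∷ u) = All-resp-↭ p h AllPairs.∷ unique-↭ p u
  unique-↭ (swap x y p)  ((x≢y ∷ hx) AllPairs.∷ (hy AllPairs.∷ u)) =
    ((λ e → x≢y (sym e)) ∷ All-resp-↭ p hy) AllPairs.∷ (All-resp-↭ p hx AllPairs.∷ unique-↭ p u)
  unique-↭ (trans p q)   u = unique-↭ q (unique-↭ p u)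

  perm⇒unique : ∀ τ → IsPerm τ → Unique τ
  perm⇒unique τ p = unique-↭ (↭-sym p) (Unique.map⁺ suc-injective (Unique.upTo⁺ (length τ)))

  -- Ranking is injective on the letters of w, so standardization keeps letters distinct.
  rank-injective : ∀ w {a b} → a ∈ w → b ∈ w → rank w a ≡ rank w b → a ≡ b
  rank-injective w {a} {b} ia ib e with <-cmp a b
  ... | tri< a<b _ _ = ⊥-elim (<-irrefl (suc-injective e) (countLess-strict a<b w ia))
  ... | tri≈ _ a≡b _ = a≡b
  ... | tri> _ _ b<a = ⊥-elim (<-irrefl (sym (suc-injective e)) (countLess-strict b<a w ib))

  unique-std : ∀ w → Unique w → Unique (std w)
  unique-std w = go w (letters-self w)
    where
    go : ∀ v → LettersOf w v → Unique v → Unique (map (rank w) v)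
    go []      []        _                = AllPairs.[]
    go (a ∷ v) (ia ∷ iv) (a∉v AllPairs.∷ u) = distinct v iv a∉v AllPairs.∷ go v iv u
      where
      distinct : ∀ v → LettersOf w v → All (a ≢_) v → All (rank w a ≢_) (map (rank w) v)
      distinct []      []        []          = []
      distinct (b ∷ v) (ib ∷ iv) (a≢b ∷ a∉v) = (λ e → a≢b (rank-injective w ia ib e)) ∷ distinct v iv a∉v

  record IsBorder (τ z : List ℕ) : Set where
    field
      prefix     : std (factor 0 (length z) τ) ≡ z
      shift      : ℕ
      shift-fits : shift + length z ≡ length τ
      suffix     : std (factor shift (length z) τ) ≡ z

  unique-border : ∀ {τ z} → IsBorder τ z → Unique τ → Unique z
  unique-border {z = z} border uτ =
    subst Unique suffix (unique-std _ (Unique.take⁺ (length z) (Unique.drop⁺ shift uτ)))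
    where open IsBorder border

  module BorderTransfer {τ z : List ℕ} (border : IsBorder τ z) (σ : List ℕ) where
    open IsBorder border renaming (shift to s)

    private
      k = length z
      m = length σ
      n = length τ

      prefix-fits : 0 + k ≤ n
      prefix-fits = ≤-trans (m≤n+m k s) (≤-reflexive shift-fits)

    via-prefix : ∀ i → OccursAt σ z i → i + m ≤ k × OccursAt σ τ i
    via-prefix i o = occurrence-from-factor σ τ 0 k i prefix-fits (subst (λ w → OccursAt σ w i) (sym prefix) o)

    from-prefix : ∀ i → i + m ≤ k → OccursAt σ τ i → OccursAt σ z i
    from-prefix i b o = subst (λ w → OccursAt σ w i) prefix (occurrence-in-factor σ τ 0 k i prefix-fits b o)

    via-suffix : ∀ i → OccursAt σ z i → i + m ≤ k × OccursAt σ τ (s + i)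
    via-suffix i o = occurrence-from-factor σ τ s k i (≤-reflexive shift-fits) (subst (λ w → OccursAt σ w i) (sym suffix) o)

    from-suffix : ∀ i → i + m ≤ k → OccursAt σ τ (s + i) → OccursAt σ z i
    from-suffix i b o = subst (λ w → OccursAt σ w i) suffix (occurrence-in-factor σ τ s k i (≤-reflexive shift-fits) b o)

    -- The prefix copy of an occurrence in z lies right of the leftmost occurrence in τ and
    -- its suffix copy lies left of the rightmost one; so z contains both extreme occurrences.
    tails : ∀ l r → LeftTail σ τ l → RightTail σ τ r → σ ≼ z → (l + m + r ≤ k) × LeftTail σ z l × RightTail σ z r
    tails l r (o-l , left-min) (p , p-fits , o-p , right-max) (i , o-i) =
      l+m+r≤k , (from-prefix l (≤-trans (m≤m+n (l + m) r) l+m+r≤k) o-l , λ j j<l o → left-min j j<l (proj₂ (via-prefix j o))) ,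
      (p ∸ s , p′-fits , from-suffix (p ∸ s) p′+m≤k (subst (OccursAt σ τ) (sym s+p′≡p) o-p) ,
       λ q p′<q o → right-max (s + q) (subst (_< s + q) s+p′≡p (+-monoʳ-< s p′<q)) (proj₂ (via-suffix q o)))
      where
      l≤i : l ≤ i
      l≤i with l ≤? i
      ... | yes l≤i = l≤i
      ... | no l≰i  = ⊥-elim (left-min i (≰⇒> l≰i) (proj₂ (via-prefix i o-i)))
      s+i≤p : s + i ≤ p
      s+i≤p with s + i ≤? p
      ... | yes le = le
      ... | no s+i≰p = ⊥-elim (right-max (s + i) (≰⇒> s+i≰p) (proj₂ (via-suffix i o-i)))
      s+p′≡p : s + (p ∸ s) ≡ p
      s+p′≡p = m+[n∸m]≡n (≤-trans (m≤m+n s i) s+i≤p)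
      p′-fits : p ∸ s + m + r ≡ k
      p′-fits = +-cancelˡ-≡ s (p ∸ s + m + r) k (begin
        s + (p ∸ s + m + r)   ≡⟨ ≡.trans (sym (+-assoc s (p ∸ s + m) r)) (cong (_+ r) (sym (+-assoc s (p ∸ s) m))) ⟩
        s + (p ∸ s) + m + r   ≡⟨ cong (λ x → x + m + r) s+p′≡p ⟩
        p + m + r             ≡⟨ ≡.trans p-fits (sym shift-fits) ⟩
        s + k                 ∎)
        where open ≡.≡-Reasoning
      p′+m≤k : p ∸ s + m ≤ k
      p′+m≤k = ≤-trans (m≤m+n (p ∸ s + m) r) (≤-reflexive p′-fits)
      l+m+r≤k : l + m + r ≤ k
      l+m+r≤k = ≤-trans (+-monoˡ-≤ r (+-monoˡ-≤ m (≤-trans l≤i i≤p′))) (≤-reflexive p′-fits)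
        where
        i≤p′ : i ≤ p ∸ s
        i≤p′ = m+n≤o⇒m≤o∸n i (≤-trans (≤-reflexive (+-comm i s)) s+i≤p)

    -- The suffix patterns of z are suffix patterns of τ (z is the pattern of a suffix of τ).
    suffixPattern-border : ∀ L → L ≤ k → suffixPattern L z ≡ suffixPattern L τ
    suffixPattern-border L L≤k = begin
      std (drop d z)                      ≡⟨ cong std (sym (take-all L (drop d z) (≤-reflexive (length-drop-exact d L z d+L≡k)))) ⟩
      std (factor d L z)                  ≡⟨ cong (λ w → std (factor d L w)) (sym suffix) ⟩
      std (factor d L (std (factor s k τ))) ≡⟨ std-factor-factor d L s k τ (≤-reflexive d+L≡k) ⟩
      std (factor (s + d) L τ)            ≡⟨ cong std (take-all L (drop (s + d) τ) (≤-reflexive (length-drop-exact (s + d) L τ s+d+L≡n))) ⟩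
      std (drop (s + d) τ)                ≡⟨ cong (λ q → std (drop q τ)) (sym n∸L≡s+d) ⟩
      std (drop (n ∸ L) τ)                ∎
      where
      open ≡.≡-Reasoning
      d = k ∸ L
      d+L≡k : d + L ≡ k
      d+L≡k = m∸n+n≡m L≤k
      s+d+L≡n : s + d + L ≡ n
      s+d+L≡n = ≡.trans (+-assoc s d L) (≡.trans (cong (s +_) d+L≡k) shift-fits)
      n∸L≡s+d : n ∸ L ≡ s + d
      n∸L≡s+d = ≡.trans (cong (_∸ L) (sym s+d+L≡n)) (m+n∸n≡m (s + d) L)
      length-drop-exact : ∀ i j (w : List ℕ) → i + j ≡ length w → length (drop i w) ≡ j
      length-drop-exact i j w e = ≡.trans (length-drop i w) (≡.trans (cong (_∸ i) (sym e)) (m+n∸m≡n i j))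

module InclusionExclusion where

  open import Defs
  open Standardization
  open PatternOrder
  open PatternSums
  open Mobius
  open Borders
  open import Data.Nat using (ℕ; zero; suc; _+_; _≤_; _<_; s≤s)
  open import Data.Nat.Properties
  open import Data.Bool using (Bool; true; false; T; T?; _∧_; _∨_; not)
  open import Data.Bool.Properties using (T-∧; T-∨)
  open import Data.List using (List; filter; length)
  open import Data.List.Membership.Propositional using (_∈_)
  open import Data.List.Membership.Propositional.Properties using (∈-filter⁻)
  import Data.List.Relation.Unary.All as All
  open import Data.List.Relation.Unary.Unique.Propositional using (Unique)
  import Data.List.Relation.Unary.Unique.Propositional.Properties as Unique
  open import Data.Integer using (ℤ; 0ℤ; 1ℤ; -_) renaming (_+_ to _+ℤ_; _-_ to _-ℤ_)
  open import Data.Product using (_×_; _,_; proj₂; ∃)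
  open import Data.Sum using (_⊎_; inj₁; inj₂)
  open import Data.Empty using (⊥; ⊥-elim)
  open import Function.Bundles using (Equivalence)
  open import Relation.Binary.Definitions using (tri<; tri≈; tri>)
  open import Relation.Nullary using (¬_)
  open import Relation.Binary.PropositionalEquality as ≡ using (_≡_; cong; cong₂; sym; subst)

  open Equivalence using (to; from)

  module Decomposition (σ τ : List ℕ) (n₂ : ℕ) (len : length τ ≡ suc (suc n₂)) where

    A B C : List ℕ
    A = std (factor 0 (suc n₂) τ)
    B = std (factor 1 (suc n₂) τ)
    C = std (factor 1 n₂ τ)

    private
      fits-A : 0 + suc n₂ ≤ length τ
      fits-A = ≤-trans (n≤1+n (suc n₂)) (≤-reflexive (sym len))
      fits-B : 1 + suc n₂ ≤ length τ
      fits-B = ≤-reflexive (sym len)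
      fits-C : 1 + n₂ ≤ length τ
      fits-C = ≤-trans (n≤1+n (suc n₂)) fits-B

    length-A : length A ≡ suc n₂
    length-A = ≡.trans (length-std (factor 0 (suc n₂) τ)) (length-factor 0 (suc n₂) τ fits-A)
    length-B : length B ≡ suc n₂
    length-B = ≡.trans (length-std (factor 1 (suc n₂) τ)) (length-factor 1 (suc n₂) τ fits-B)
    length-C : length C ≡ n₂
    length-C = ≡.trans (length-std (factor 1 n₂ τ)) (length-factor 1 n₂ τ fits-C)

    A≼τ : A ≼ τ
    A≼τ = factor-≼ 0 (suc n₂) τ fits-A
    B≼τ : B ≼ τ
    B≼τ = factor-≼ 1 (suc n₂) τ fits-B
    C≼τ : C ≼ τ
    C≼τ = factor-≼ 1 n₂ τ fits-C

    in-A : ∀ z i → OccursAt z τ i → i + length z ≤ suc n₂ → z ≼ A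
    in-A z i o b = i , occurrence-in-factor z τ 0 (suc n₂) i fits-A b o
    in-B : ∀ z i → OccursAt z τ (suc i) → i + length z ≤ suc n₂ → z ≼ B
    in-B z i o b = i , occurrence-in-factor z τ 1 (suc n₂) i fits-B b o
    in-C : ∀ z i → OccursAt z τ (suc i) → i + length z ≤ n₂ → z ≼ C
    in-C z i o b = i , occurrence-in-factor z τ 1 n₂ i fits-C b o

    C≼A : C ≼ A
    C≼A = in-A C 1 (proj₂ C≼τ) (≤-reflexive (cong suc length-C))
    C≼B : C ≼ B
    C≼B = in-B C 0 (proj₂ C≼τ) (≤-trans (≤-reflexive length-C) (n≤1+n n₂))

    U : List (List ℕ)
    U = properPatterns τ

    below-A-or-B : ∀ z → z ∈ U → T (occursᵇ z A ∨ occursᵇ z B)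
    below-A-or-B z z∈U with properPatterns-sound τ z z∈U
    ... | (zero , b , e) , z<τ = from (T-∨ {occursᵇ z A}) (inj₁ (occursᵇ-complete z A
            (in-A z 0 (b , e) (≤-pred (≤-trans z<τ (≤-reflexive len))))))
    ... | (suc i , b , e) , _  = from (T-∨ {occursᵇ z A}) (inj₂ (occursᵇ-complete z B
            (in-B z i (b , e) (≤-pred (≤-trans b (≤-reflexive len))))))

    below-C⇒below-A-and-B : ∀ z → T (occursᵇ z C) → T (occursᵇ z A) × T (occursᵇ z B)
    below-C⇒below-A-and-B z t = let z≼C = occursᵇ-sound z C t in
      occursᵇ-complete z A (≼-trans z≼C C≼A) , occursᵇ-complete z B (≼-trans z≼C C≼B)

    Σ[_] : List ℕ → ℤ
    Σ[ w ] = sumOver (μ σ) (interval σ w U)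

    isCorrection : List ℕ → Bool
    isCorrection z = ((occursᵇ σ z ∧ occursᵇ z A) ∧ occursᵇ z B) ∧ not (occursᵇ z C)

    corrections : List (List ℕ)
    corrections = filter (λ z → T? (isCorrection z)) U

    Σcorrections : ℤ
    Σcorrections = sumOver (μ σ) corrections

    -- [σ,τ) = [σ,A] ∪ [σ,B] and [σ,A] ∩ [σ,B] = [σ,C] ⊎ corrections.
    halfInterval-sum : sumOver (μ σ) (halfInterval σ τ) ≡ Σ[ A ] +ℤ Σ[ B ] -ℤ (Σ[ C ] +ℤ Σcorrections)
    halfInterval-sum = begin
      sumOver (μ σ) (halfInterval σ τ)
        ≡⟨ sumOver-filter (μ σ) (occursᵇ σ) U ⟩
      sumOver (λ z → restrict (occursᵇ σ z) (μ σ z)) U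
        ≡⟨ sumOver-cong _ _ U (All.tabulate λ {z} z∈U → restrict-split (occursᵇ σ z) (occursᵇ z A) (occursᵇ z B)
             (occursᵇ z C) (μ σ z) (below-A-or-B z z∈U) (below-C⇒below-A-and-B z)) ⟩
      sumOver (λ z → r-A z +ℤ r-B z -ℤ (r-C z +ℤ r-corr z)) U
        ≡⟨ sumOver-- (λ z → r-A z +ℤ r-B z) (λ z → r-C z +ℤ r-corr z) U ⟩
      sumOver (λ z → r-A z +ℤ r-B z) U -ℤ sumOver (λ z → r-C z +ℤ r-corr z) U
        ≡⟨ cong₂ _-ℤ_ (sumOver-+ r-A r-B U) (sumOver-+ r-C r-corr U) ⟩
      sumOver r-A U +ℤ sumOver r-B U -ℤ (sumOver r-C U +ℤ sumOver r-corr U)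
        ≡⟨ sym (cong₂ _-ℤ_ (cong₂ _+ℤ_ (sumOver-filter (μ σ) (inInterval σ A) U) (sumOver-filter (μ σ) (inInterval σ B) U))
                           (cong₂ _+ℤ_ (sumOver-filter (μ σ) (inInterval σ C) U) (sumOver-filter (μ σ) isCorrection U))) ⟩
      Σ[ A ] +ℤ Σ[ B ] -ℤ (Σ[ C ] +ℤ Σcorrections) ∎
      where
      open ≡.≡-Reasoning
      r-A r-B r-C r-corr : List ℕ → ℤ
      r-A z = restrict (inInterval σ A z) (μ σ z)
      r-B z = restrict (inInterval σ B z) (μ σ z)
      r-C z = restrict (inInterval σ C z) (μ σ z)
      r-corr z = restrict (isCorrection z) (μ σ z)

    μ-decomposition : ¬ σ ≡ τ → σ ≼ τ → μ σ τ ≡ - (Σ[ A ] +ℤ Σ[ B ] -ℤ (Σ[ C ] +ℤ Σcorrections))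
    μ-decomposition σ≢τ σ≼τ = ≡.trans (μ-unfold σ τ σ≢τ σ≼τ) (cong -_ halfInterval-sum)

    Σ-proper-pattern : ∀ w → w ≼ τ → length w < length τ → (σ ≡ w → Σ[ w ] ≡ 1ℤ) × (¬ σ ≡ w → Σ[ w ] ≡ 0ℤ)
    Σ-proper-pattern w w≼τ w<τ =
      (λ { ≡.refl → interval-sum-≡ σ U (≼-std w≼τ) (properPatterns-unique τ) cover }) ,
      interval-sum-≢ σ w U (≼-std w≼τ) (properPatterns-unique τ) cover
      where
      cover : ∀ z → z ≼ w → z ∈ U
      cover z z≼w = properPatterns-complete τ z (≼-trans z≼w w≼τ) (≤-<-trans (≼-length z≼w) w<τ)

    prefix-not-below-C : ∀ z → z ≼ A → ¬ z ≼ C → length z ≤ suc n₂ × std (factor 0 (length z) τ) ≡ z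
    prefix-not-below-C z (i , o) z⋠C with occurrence-from-factor z τ 0 (suc n₂) i fits-A o
    ... | fits , (_ , e) with i
    ...   | zero   = fits , e
    ...   | suc i′ = ⊥-elim (z⋠C (in-C z i′ (fits′ , e) (≤-pred fits)))
      where
      fits′ : suc i′ + length z ≤ length τ
      fits′ = ≤-trans (n≤1+n _) (≤-trans (s≤s fits) fits-B)

    suffix-not-below-C : ∀ z → z ≼ B → ¬ z ≼ C → ∃ λ j → j + length z ≡ suc n₂ × std (factor (suc j) (length z) τ) ≡ z
    suffix-not-below-C z (j , o) z⋠C with occurrence-from-factor z τ 1 (suc n₂) j fits-B o
    ... | fits , o′ with m≤n⇒m<n∨m≡n fits
    ...   | inj₁ short = ⊥-elim (z⋠C (in-C z j o′ (≤-pred short)))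
    ...   | inj₂ exact = j , exact , proj₂ o′

    -- Of two borders of τ of length at most n₂, the shorter one lies below C: it is a
    -- suffix pattern of the longer one, which is the prefix pattern of τ.
    shorter-border-below-C : ∀ {z₁ z₂} → IsBorder τ z₁ → IsBorder τ z₂ → length z₁ < length z₂ → length z₂ ≤ n₂ → z₁ ≼ C
    shorter-border-below-C {z₁} {z₂} b₁ b₂ z₁<z₂ z₂≤n₂ with m≤n⇒∃[o]m+o≡n z₁<z₂
    ... | o , eo = in-C z₁ o (proj₂ (via-prefix (suc o) (from-suffix (suc o) (≤-reflexive k₂≡) at-s₂+1+o))) o+k₁≤n₂
      where
      open BorderTransfer b₂ z₁ using (via-prefix; from-suffix)
      open IsBorder b₁ renaming (shift to s₁; shift-fits to fits₁; suffix to suffix₁)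
      open IsBorder b₂ renaming (shift to s₂; shift-fits to fits₂)
      k₁ = length z₁
      k₂ = length z₂
      k₂≡ : suc o + k₁ ≡ k₂
      k₂≡ = ≡.trans (cong suc (+-comm o k₁)) eo
      s₂+1+o≡s₁ : s₂ + suc o ≡ s₁
      s₂+1+o≡s₁ = +-cancelʳ-≡ k₁ (s₂ + suc o) s₁
        (≡.trans (+-assoc s₂ (suc o) k₁) (≡.trans (cong (s₂ +_) k₂≡) (≡.trans fits₂ (sym fits₁))))
      at-s₂+1+o : OccursAt z₁ τ (s₂ + suc o)
      at-s₂+1+o = subst (OccursAt z₁ τ) (sym s₂+1+o≡s₁) (≤-reflexive fits₁ , suffix₁)
      o+k₁≤n₂ : o + k₁ ≤ n₂
      o+k₁≤n₂ = ≤-trans (n≤1+n (o + k₁)) (≤-trans (≤-reflexive (cong suc (+-comm o k₁))) (≤-trans (≤-reflexive eo) z₂≤n₂))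

    -- Borders of length at most n₂ that are not below C are determined by their length,
    -- and by the previous lemma there is at most one such length.
    borders-not-below-C-equal : ∀ {z₁ z₂} → IsBorder τ z₁ → length z₁ ≤ n₂ → ¬ z₁ ≼ C →
                                IsBorder τ z₂ → length z₂ ≤ n₂ → ¬ z₂ ≼ C → z₁ ≡ z₂
    borders-not-below-C-equal {z₁} {z₂} b₁ k₁≤ z₁⋠C b₂ k₂≤ z₂⋠C with <-cmp (length z₁) (length z₂)
    ... | tri< lt _ _ = ⊥-elim (z₁⋠C (shorter-border-below-C b₁ b₂ lt k₂≤))
    ... | tri> _ _ gt = ⊥-elim (z₂⋠C (shorter-border-below-C b₂ b₁ gt k₁≤))
    ... | tri≈ _ eq _ = ≡.trans (sym (IsBorder.prefix b₁))
                          (≡.trans (cong (λ l → std (factor 0 l τ)) eq) (IsBorder.prefix b₂))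

    correction-parts : ∀ z → z ∈ corrections → σ ≼ z × z ≼ A × z ≼ B × ¬ z ≼ C
    correction-parts z m with to T-∧ (proj₂ (∈-filter⁻ (λ z → T? (isCorrection z)) {xs = U} m))
    ... | t , not-C with to T-∧ t
    ...   | t′ , t-B with to T-∧ t′
    ...     | t-σ , t-A = occursᵇ-sound σ z t-σ , occursᵇ-sound z A t-A , occursᵇ-sound z B t-B ,
                          λ z≼C → not-T (occursᵇ z C) not-C (occursᵇ-complete z C z≼C)
      where
      not-T : ∀ b → T (not b) → T b → ⊥
      not-T false _ ()
      not-T true  ()

    module _ (A≢B : ¬ A ≡ B) where

      correction⇒border : ∀ z → z ∈ corrections → σ ≼ z × length z ≤ n₂ × IsBorder τ z × ¬ z ≼ C
      correction⇒border z m with correction-parts z m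
      ... | σ≼z , z≼A , z≼B , z⋠C with prefix-not-below-C z z≼A z⋠C | suffix-not-below-C z z≼B z⋠C
      ...   | k≤ , prefix | j , j-fits , suffix =
        σ≼z , shorter-than-A , record { prefix = prefix ; shift = suc j ; shift-fits = ≡.trans (cong suc j-fits) (sym len) ; suffix = suffix } , z⋠C
        where
        -- A border of length n₂ + 1 would be both A and B.
        shorter-than-A : length z ≤ n₂
        shorter-than-A with m≤n⇒m<n∨m≡n k≤
        ... | inj₁ k<  = ≤-pred k<
        ... | inj₂ k≡ = ⊥-elim (A≢B (begin
          A                                ≡⟨ cong (λ l → std (factor 0 l τ)) (sym k≡) ⟩
          std (factor 0 (length z) τ)      ≡⟨ prefix ⟩
          z                                ≡⟨ sym suffix ⟩
          std (factor (suc j) (length z) τ) ≡⟨ cong (λ q → std (factor (suc q) (length z) τ)) j≡0 ⟩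
          std (factor 1 (length z) τ)      ≡⟨ cong (λ l → std (factor 1 l τ)) k≡ ⟩
          B                                ∎))
          where
          open ≡.≡-Reasoning
          j≡0 : j ≡ 0
          j≡0 = +-cancelʳ-≡ (length z) j 0 (≡.trans j-fits (sym k≡))

      corrections-unique : ∀ z₁ z₂ → z₁ ∈ corrections → z₂ ∈ corrections → z₁ ≡ z₂
      corrections-unique z₁ z₂ m₁ m₂ =
        let (_ , k₁≤ , b₁ , z₁⋠C) = correction⇒border z₁ m₁
            (_ , k₂≤ , b₂ , z₂⋠C) = correction⇒border z₂ m₂
        in borders-not-below-C-equal b₁ k₁≤ z₁⋠C b₂ k₂≤ z₂⋠C

      correction-sum : Σcorrections ≡ 0ℤ ⊎ ∃ λ z → σ ≼ z × length z ≤ n₂ × IsBorder τ z × Σcorrections ≡ μ σ z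
      correction-sum = shape (sumOver-subsingleton (μ σ) corrections
        (Unique.filter⁺ (λ z → T? (isCorrection z)) (properPatterns-unique τ)) corrections-unique)
        where
        shape : Σcorrections ≡ 0ℤ ⊎ ∃ (λ z → z ∈ corrections × Σcorrections ≡ μ σ z) →
                Σcorrections ≡ 0ℤ ⊎ ∃ λ z → σ ≼ z × length z ≤ n₂ × IsBorder τ z × Σcorrections ≡ μ σ z
        shape (inj₁ e)           = inj₁ e
        shape (inj₂ (z , m , e)) = let (σ≼z , z≤n₂ , border , _) = correction⇒border z m in inj₂ (z , σ≼z , z≤n₂ , border , e)

module Sign where

  open import Data.Nat using (zero; suc; _+_)
  open import Data.Nat.Properties using (+-comm)
  open import Data.Integer using (0ℤ; 1ℤ; -1ℤ; -_; _*_; _^_)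
  open import Data.Integer.Properties using (-1*i≡-i)
  open import Data.Sum using (_⊎_; inj₁; inj₂)
  open import Relation.Binary.PropositionalEquality using (_≡_; _≢_; refl; trans; cong)

  -- (-1)^x is ±1, and raising the exponent by one flips its sign; hence (-1)^(x+1) is
  -- neither 0 nor (-1)^x.
  sign-cases : ∀ x → -1ℤ ^ x ≡ 1ℤ ⊎ -1ℤ ^ x ≡ -1ℤ
  sign-cases zero = inj₁ refl
  sign-cases (suc x) with sign-cases x
  ... | inj₁ e = inj₂ (cong (-1ℤ *_) e)
  ... | inj₂ e = inj₁ (cong (-1ℤ *_) e)

  sign-step : ∀ x → -1ℤ ^ (x + 1) ≡ - (-1ℤ ^ x)
  sign-step x = trans (cong (-1ℤ ^_) (+-comm x 1)) (-1*i≡-i (-1ℤ ^ x))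

  next-sign-differs : ∀ x v → v ≡ 0ℤ ⊎ v ≡ -1ℤ ^ x → v ≢ -1ℤ ^ (x + 1)
  next-sign-differs x v v∈ v≡next = impossible v∈ (sign-cases x) (trans v≡next (sign-step x))
    where
    impossible : ∀ {v s} → v ≡ 0ℤ ⊎ v ≡ s → s ≡ 1ℤ ⊎ s ≡ -1ℤ → v ≢ - s
    impossible (inj₁ refl) (inj₁ refl) ()
    impossible (inj₁ refl) (inj₂ refl) ()
    impossible (inj₂ refl) (inj₁ refl) ()
    impossible (inj₂ refl) (inj₂ refl) ()

module MainInduction where

  open import Defs
  open PatternOrder
  open Mobius
  open Borders
  open MonotoneSuffix
  open InclusionExclusion
  open import Data.Nat using (ℕ; zero; suc; _+_; _∸_; _≤_; _<_; z≤n; s≤s; s≤s⁻¹)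
  open import Data.Nat.Properties
  open import Data.List using (List; []; _∷_; length)
  open import Data.List.Properties using (≡-dec; drop-all)
  open import Data.List.Relation.Unary.Unique.Propositional using (Unique)
  open import Data.Integer using (0ℤ; -1ℤ; -_; _^_) renaming (_+_ to _+ℤ_; _-_ to _-ℤ_)
  open import Data.Product using (_×_; _,_; proj₁; proj₂; ∃)
  open import Data.Sum using (_⊎_; inj₁; inj₂; [_,_]′)
  import Data.Sum
  open import Data.Empty using (⊥; ⊥-elim)
  open import Relation.Nullary using (¬_; Dec; yes; no)
  open import Function using (id)
  open import Data.Integer.Solver using (module +-*-Solver)
  open import Relation.Binary.PropositionalEquality as ≡ using (_≡_; _≢_; cong; cong₂; sym; subst)

  record Hypotheses (σ τ : List ℕ) (l r : ℕ) : Set where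
    field
      left-tail           : LeftTail σ τ l
      right-tail          : RightTail σ τ r
      l≤1                 : l ≤ 1
      r≤1                 : r ≤ 1
      balanced            : l + r ≡ 1 → r ≡ 0
      suffix-not-monotone : ¬ Monotone (suffixPattern (length σ + (l + r)) τ)

  ZeroOrSign : List ℕ → List ℕ → ℕ → ℕ → Set
  ZeroOrSign σ τ l r = μ σ τ ≡ 0ℤ ⊎ μ σ τ ≡ -1ℤ ^ (l + r)

  ≤1-cases : ∀ {x} → x ≤ 1 → x ≡ 0 ⊎ x ≡ 1
  ≤1-cases z≤n       = inj₁ ≡.refl
  ≤1-cases (s≤s z≤n) = inj₂ ≡.refl

  module TailFacts {σ τ : List ℕ} {l r : ℕ} (h : Hypotheses σ τ l r) where
    open Hypotheses h

    leftmost-≤ : ∀ i → OccursAt σ τ i → l ≤ i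
    leftmost-≤ i o with l ≤? i
    ... | yes l≤i = l≤i
    ... | no l≰i  = ⊥-elim (proj₂ left-tail i (≰⇒> l≰i) o)

    ≤-rightmost : ∀ i → OccursAt σ τ i → i + length σ + r ≤ length τ
    ≤-rightmost i o with right-tail
    ... | p , p-fits , _ , right-max with i ≤? p
    ...   | yes i≤p = ≤-trans (+-monoˡ-≤ r (+-monoˡ-≤ (length σ) i≤p)) (≤-reflexive p-fits)
    ...   | no i≰p  = ⊥-elim (right-max i (≰⇒> i≰p) o)

    occurs-at-end : r ≡ 0 → ∀ q → q + length σ ≡ length τ → OccursAt σ τ q
    occurs-at-end r≡0 q q-fits with right-tail
    ... | p , p-fits , o-p , _ = subst (OccursAt σ τ) p≡q o-p
      where
      p≡q : p ≡ q
      p≡q = +-cancelʳ-≡ (length σ) p q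
        (≡.trans (sym (≡.trans (cong (p + length σ +_) r≡0) (+-identityʳ _))) (≡.trans p-fits (sym q-fits)))

    no-left-tail⇒no-right-tail : l ≡ 0 → r ≡ 0
    no-left-tail⇒no-right-tail l≡0 with ≤1-cases r≤1
    ... | inj₁ r≡0 = r≡0
    ... | inj₂ r≡1 = balanced (cong₂ _+_ l≡0 r≡1)

  ClaimBelow : ℕ → Set
  ClaimBelow N = ∀ σ τ → length τ < N → Unique τ → ∀ l r → Hypotheses σ τ l r → ZeroOrSign σ τ l r

  module Step (N : ℕ) (IH : ClaimBelow N) (σ τ : List ℕ) (n₂ : ℕ) (len : length τ ≡ suc (suc n₂))
              (τ≤N : length τ ≤ N) (uτ : Unique τ) (σ≢τ : ¬ σ ≡ τ) {l r : ℕ} (h : Hypotheses σ τ l r) where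
    open Decomposition σ τ n₂ len
    open Hypotheses h
    open TailFacts h

    private
      m = length σ
      n = length τ

    σ≼τ : σ ≼ τ
    σ≼τ = l , proj₁ left-tail

    -- Two adjacent occurrences, the second ending at the end of τ, would make the
    -- suffix pattern of length |σ| + l + r monotone.
    no-adjacent-at-end : r ≡ 0 → ∀ q → OccursAt σ τ q → OccursAt σ τ (suc q) → suc q + m ≡ n → ⊥
    no-adjacent-at-end r≡0 q o o′ end =
      suffix-not-monotone (adjacent-occurrences⇒monotone σ τ q o o′ end uτ (n ∸ (m + (l + r))) (m+n≤o⇒m≤o∸n q fits))
      where
      fits : q + (m + (l + r)) ≤ n
      fits = begin
        q + (m + (l + r)) ≡⟨ cong (λ x → q + (m + (l + x))) r≡0 ⟩
        q + (m + (l + 0)) ≤⟨ +-monoʳ-≤ q (+-monoʳ-≤ m (≤-trans (≤-reflexive (+-identityʳ l)) l≤1)) ⟩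
        q + (m + 1)       ≡⟨ ≡.trans (cong (q +_) (+-comm m 1)) (+-suc q m) ⟩
        suc q + m         ≡⟨ end ⟩
        n                 ∎
        where open ≤-Reasoning

    -- A = B would be a pattern occurring at positions 0 and 1 of τ, ending at its end.
    A≢B : ¬ A ≡ B
    A≢B A≡B = suffix-not-monotone (adjacent-occurrences⇒monotone A τ 0 (proj₂ A≼τ)
      (subst (λ w → OccursAt w τ 1) (sym A≡B) (proj₂ B≼τ)) (≡.trans (cong suc length-A) (sym len)) uτ (n ∸ (m + (l + r))) z≤n)

    private
      occurs-as : ∀ {w} i → σ ≡ w → OccursAt w τ i → OccursAt σ τ i
      occurs-as i σ≡w = subst (λ v → OccursAt v τ i) (sym σ≡w)

      length-as : ∀ {w} → σ ≡ w → m ≡ length w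
      length-as = cong length

    σ≢A : ¬ σ ≡ A
    σ≢A σ≡A = no-adjacent-at-end r≡0 0 at-0 (occurs-at-end r≡0 1 (≡.trans (cong suc m≡) (sym len))) (≡.trans (cong suc m≡) (sym len))
      where
      m≡ : m ≡ suc n₂
      m≡ = ≡.trans (length-as σ≡A) length-A
      at-0 : OccursAt σ τ 0
      at-0 = occurs-as 0 σ≡A (proj₂ A≼τ)
      r≡0 : r ≡ 0
      r≡0 = no-left-tail⇒no-right-tail (n≤0⇒n≡0 (leftmost-≤ 0 at-0))

    σ≡B⇒tails : σ ≡ B → l ≡ 1 × r ≡ 0
    σ≡B⇒tails σ≡B = l≡1 , r≡0
      where
      1+m≡n : suc m ≡ n
      1+m≡n = ≡.trans (cong suc (≡.trans (length-as σ≡B) length-B)) (sym len)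
      at-1 : OccursAt σ τ 1
      at-1 = occurs-as 1 σ≡B (proj₂ B≼τ)
      r≡0 : r ≡ 0
      r≡0 = n≤0⇒n≡0 (+-cancelˡ-≤ (suc m) r 0 (≤-trans (≤-rightmost 1 at-1) (≤-reflexive (sym (≡.trans (+-identityʳ (suc m)) 1+m≡n)))))
      l≡1 : l ≡ 1
      l≡1 with ≤1-cases l≤1
      ... | inj₂ l≡1 = l≡1
      ... | inj₁ l≡0 = ⊥-elim (no-adjacent-at-end r≡0 0 (subst (OccursAt σ τ) l≡0 (proj₁ left-tail)) at-1 1+m≡n)

    σ≡C⇒tails : σ ≡ C → l ≡ 1 × r ≡ 1
    σ≡C⇒tails σ≡C = l≡1 , r≡1
      where
      2+m≡n : suc (suc m) ≡ n
      2+m≡n = ≡.trans (cong (λ k → suc (suc k)) (≡.trans (length-as σ≡C) length-C)) (sym len)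
      at-1 : OccursAt σ τ 1
      at-1 = occurs-as 1 σ≡C (proj₂ C≼τ)
      r≡1 : r ≡ 1
      r≡1 with ≤1-cases r≤1
      ... | inj₂ r≡1 = r≡1
      ... | inj₁ r≡0 = ⊥-elim (no-adjacent-at-end r≡0 1 at-1 (occurs-at-end r≡0 2 2+m≡n) 2+m≡n)
      l≡1 : l ≡ 1
      l≡1 with ≤1-cases l≤1
      ... | inj₂ l≡1 = l≡1
      ... | inj₁ l≡0 with ≡.trans (sym r≡1) (no-left-tail⇒no-right-tail l≡0)
      ...   | ()

    -- The correction term is 0, or it is μ(σ,z) for a border z of τ to which the
    -- induction hypothesis applies; in the latter case it is (-1)^(l+r) or 0 and σ,
    -- with both tails, fits into n₂ letters.
    correction-value : Σcorrections ≡ 0ℤ ⊎ (Σcorrections ≡ -1ℤ ^ (l + r) × l + m + r ≤ n₂)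
    correction-value = from-border (correction-sum A≢B)
      where
      from-border : Σcorrections ≡ 0ℤ ⊎ ∃ (λ z → σ ≼ z × length z ≤ n₂ × IsBorder τ z × Σcorrections ≡ μ σ z) →
                    Σcorrections ≡ 0ℤ ⊎ (Σcorrections ≡ -1ℤ ^ (l + r) × l + m + r ≤ n₂)
      from-border (inj₁ e) = inj₁ e
      from-border (inj₂ (z , σ≼z , z≤n₂ , border , e)) = conclude (IH σ z z<N (unique-border border uτ) l r hyp-z)
        where
        open BorderTransfer border σ using (tails; suffixPattern-border)
        transferred : (l + m + r ≤ length z) × LeftTail σ z l × RightTail σ z r
        transferred = tails l r left-tail right-tail σ≼z
        z<N : length z < N
        z<N = ≤-<-trans z≤n₂ (≤-trans (≤-trans (n≤1+n (suc n₂)) (≤-reflexive (sym len))) τ≤N)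
        hyp-z : Hypotheses σ z l r
        hyp-z = record
          { left-tail = proj₁ (proj₂ transferred) ; right-tail = proj₂ (proj₂ transferred)
          ; l≤1 = l≤1 ; r≤1 = r≤1 ; balanced = balanced
          ; suffix-not-monotone = λ mono → suffix-not-monotone
              (subst Monotone (suffixPattern-border (m + (l + r)) (≤-trans (≤-reflexive (rearrange l m r)) (proj₁ transferred))) mono) }
          where
          rearrange : ∀ l m r → m + (l + r) ≡ l + m + r
          rearrange l m r = ≡.trans (sym (+-assoc m l r)) (cong (_+ r) (+-comm m l))
        conclude : ZeroOrSign σ z l r → Σcorrections ≡ 0ℤ ⊎ (Σcorrections ≡ -1ℤ ^ (l + r) × l + m + r ≤ n₂)
        conclude (inj₁ μ≡0)    = inj₁ (≡.trans e μ≡0)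
        conclude (inj₂ μ≡sign) = inj₂ (≡.trans e μ≡sign , ≤-trans (proj₁ transferred) z≤n₂)

    correction-vanishes : n₂ < l + m + r → Σcorrections ≡ 0ℤ
    correction-vanishes long = [ id , (λ (_ , fits) → ⊥-elim (<⇒≱ long fits)) ]′ correction-value

    private
      A<τ : length A < n
      A<τ = subst (_< n) (sym length-A) (≤-reflexive (sym len))
      B<τ : length B < n
      B<τ = subst (_< n) (sym length-B) (≤-reflexive (sym len))
      C<τ : length C < n
      C<τ = subst (_< n) (sym length-C) (≤-trans (n≤1+n (suc n₂)) (≤-reflexive (sym len)))

      σ≢-by-length : ∀ {w} → length w ≢ m → ¬ σ ≡ w
      σ≢-by-length w≢m σ≡w = w≢m (sym (length-as σ≡w))

      Σ-A : Σ[ A ] ≡ 0ℤ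
      Σ-A = proj₂ (Σ-proper-pattern A A≼τ A<τ) σ≢A

    μ-from : ∀ {b c d} → Σ[ B ] ≡ b → Σ[ C ] ≡ c → Σcorrections ≡ d → μ σ τ ≡ - (0ℤ +ℤ b -ℤ (c +ℤ d))
    μ-from ≡.refl ≡.refl ≡.refl = ≡.trans (μ-decomposition σ≢τ σ≼τ) (cong (λ a → - (a +ℤ Σ[ B ] -ℤ (Σ[ C ] +ℤ Σcorrections))) Σ-A)

    -- σ ∉ {A, B, C}: μ(σ,τ) equals the correction term.
    generic : ¬ σ ≡ B → ¬ σ ≡ C → ZeroOrSign σ τ l r
    generic σ≢B σ≢C = Data.Sum.map (≡.trans μ≡correction) (λ (e , _) → ≡.trans μ≡correction e) correction-value
      where
      μ≡correction : μ σ τ ≡ Σcorrections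
      μ≡correction = ≡.trans (μ-from (proj₂ (Σ-proper-pattern B B≼τ B<τ) σ≢B) (proj₂ (Σ-proper-pattern C C≼τ C<τ) σ≢C) ≡.refl)
        (solve 1 (λ d → :- (con 0ℤ :+ con 0ℤ :- (con 0ℤ :+ d)) := d) ≡.refl Σcorrections)
        where open +-*-Solver

    at-B : σ ≡ B → ZeroOrSign σ τ l r
    at-B σ≡B = inj₂ (≡.trans (μ-from (proj₁ (Σ-proper-pattern B B≼τ B<τ) σ≡B) (proj₂ (Σ-proper-pattern C C≼τ C<τ) σ≢C)
                               (correction-vanishes long))
                             (cong₂ (λ a b → -1ℤ ^ (a + b)) (sym (proj₁ tails)) (sym (proj₂ tails))))
      where
      tails : l ≡ 1 × r ≡ 0
      tails = σ≡B⇒tails σ≡B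
      m≡ : m ≡ suc n₂
      m≡ = ≡.trans (length-as σ≡B) length-B
      σ≢C : ¬ σ ≡ C
      σ≢C = σ≢-by-length (λ C≡m → 1+n≢n (sym (≡.trans (sym length-C) (≡.trans C≡m m≡))))
      long : n₂ < l + m + r
      long = ≤-trans (≤-reflexive (sym m≡)) (≤-trans (m≤n+m m l) (m≤m+n (l + m) r))

    at-C : σ ≡ C → ZeroOrSign σ τ l r
    at-C σ≡C = inj₂ (≡.trans (μ-from (proj₂ (Σ-proper-pattern B B≼τ B<τ) σ≢B) (proj₁ (Σ-proper-pattern C C≼τ C<τ) σ≡C)
                               (correction-vanishes long))
                             (cong₂ (λ a b → -1ℤ ^ (a + b)) (sym (proj₁ tails)) (sym (proj₂ tails))))
      where
      tails : l ≡ 1 × r ≡ 1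
      tails = σ≡C⇒tails σ≡C
      m≡ : m ≡ n₂
      m≡ = ≡.trans (length-as σ≡C) length-C
      σ≢B : ¬ σ ≡ B
      σ≢B = σ≢-by-length (λ B≡m → 1+n≢n (≡.trans (sym length-B) (≡.trans B≡m m≡)))
      long : n₂ < l + m + r
      long = ≤-trans (≤-reflexive (cong suc (sym m≡))) (≤-trans (≤-reflexive (cong (_+ m) (sym (proj₁ tails)))) (m≤m+n (l + m) r))

    step : ZeroOrSign σ τ l r
    step = decide (≡-dec _≟_ σ B) (≡-dec _≟_ σ C)
      where
      decide : Dec (σ ≡ B) → Dec (σ ≡ C) → ZeroOrSign σ τ l r
      decide (yes σ≡B) _         = at-B σ≡B
      decide (no σ≢B)  (yes σ≡C) = at-C σ≡C
      decide (no σ≢B)  (no σ≢C)  = generic σ≢B σ≢C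

  -- σ = τ: both tails are empty and μ(σ,σ) = 1 = (-1)^0.
  claim-refl : ∀ σ l r → Hypotheses σ σ l r → ZeroOrSign σ σ l r
  claim-refl σ l r h = inj₂ (≡.trans (μ-refl σ) (cong (-1ℤ ^_) (sym (cong₂ _+_ l≡0 (no-left-tail⇒no-right-tail l≡0)))))
    where
    open Hypotheses h
    open TailFacts h
    l≡0 : l ≡ 0
    l≡0 = n≤0⇒n≡0 (+-cancelʳ-≤ (length σ) l 0 (proj₁ (proj₁ left-tail)))

  -- The empty pattern occurs at position 0, so it has no tails, and the suffix pattern
  -- of length 0 is the (monotone) empty permutation.
  empty-pattern-excluded : ∀ τ l r → ¬ Hypotheses [] τ l r
  empty-pattern-excluded τ l r h = suffix-not-monotone
    (subst (λ x → Monotone (suffixPattern x τ)) (sym l+r≡0)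
      (subst (λ v → Monotone (std v)) (sym (drop-all (length τ) τ ≤-refl)) (inj₁ ≡.refl)))
    where
    open Hypotheses h
    open TailFacts h
    l≡0 : l ≡ 0
    l≡0 = n≤0⇒n≡0 (leftmost-≤ 0 (z≤n , ≡.refl))
    l+r≡0 : l + r ≡ 0
    l+r≡0 = cong₂ _+_ l≡0 (no-left-tail⇒no-right-tail l≡0)

  claim : ∀ N → ClaimBelow N
  claim zero    σ          τ ()
  claim (suc N) []         τ _   _  l r h = ⊥-elim (empty-pattern-excluded τ l r h)
  claim (suc N) σ@(_ ∷ _)  τ τ<N uτ l r h = by-cases (≡-dec _≟_ σ τ)
    where
    σ≼τ : σ ≼ τ
    σ≼τ = l , proj₁ (Hypotheses.left-tail h)
    by-cases : Dec (σ ≡ τ) → ZeroOrSign σ τ l r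
    by-cases (yes ≡.refl) = claim-refl σ l r h
    by-cases (no σ≢τ) with length τ ≤? length σ
    ... | yes τ≤σ = inj₁ (μ-no-longer σ τ σ≢τ σ≼τ τ≤σ)
    ... | no τ≰σ  = Step.step N (claim N) σ τ (length τ ∸ 2) (sym (m+[n∸m]≡n 2≤τ)) (s≤s⁻¹ τ<N) uτ σ≢τ h
      where
      2≤τ : 2 ≤ length τ
      2≤τ = ≤-trans (s≤s (s≤s z≤n)) (≰⇒> τ≰σ)

open import Defs
open import Data.Nat using (ℕ; suc; _+_; _≤_)
open import Data.Nat.Properties using (≤-refl)
open import Data.List using (List; length)
open import Data.Integer using (ℤ; -1ℤ; _^_)
open import Relation.Nullary using (¬_)
open import Relation.Binary.PropositionalEquality using (_≡_; _≢_)

open Borders using (perm⇒unique)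
open Sign using (next-sign-differs)
open MainInduction using (Hypotheses; claim)

proposition3p8 : (σ τ : List ℕ) → IsPerm σ → IsPerm τ → σ ≼ τ →
    (l r : ℕ) → LeftTail σ τ l → RightTail σ τ r → l ≤ 1 → r ≤ 1 →
    (l + r ≡ 1 → r ≡ 0) →
    ¬ Monotone (suffixPattern (length σ + (l + r)) τ) →
    μ σ τ ≢ -1ℤ ^ (l + r + 1)
proposition3p8 σ τ _ τ-perm _ l r left right l≤1 r≤1 balanced not-monotone =
  next-sign-differs (l + r) (μ σ τ) (claim (suc (length τ)) σ τ ≤-refl (perm⇒unique τ τ-perm) l r hypotheses)
  where
  hypotheses : Hypotheses σ τ l r
  hypotheses = record
    { left-tail = left ; right-tail = right ; l≤1 = l≤1 ; r≤1 = r≤1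
    ; balanced = balanced ; suffix-not-monotone = not-monotone }
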